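{- Let $\alpha$ and $\beta$ be dotted compositions, and let $w_\alpha$, $w_\beta$ be dotted permutations representing $\alpha$ on a finite set $S\subset\mathbb Z$ and $\beta$ on a finite set $T\subset\mathbb Z$ respectively, where $s<t$ for all $s\in S$, $t\in T$. Then, in the ring of quasisymmetric functions in superspace (with its ordinary multiplication), $$L_\alpha L_\beta=\sum_{P}\operatorname{sign}(P)\,L_{\mathrm{comp}(\Pi(P))},$$ where the sum is over all fundamental paths $P$ in the $(\alpha,\beta)$-grid built from $w_\alpha,w_\beta$.
   Context: Variables: commuting $x_1,x_2,\dots$ and anticommuting $\theta_1,\theta_2,\dots$ ($\theta_i\theta_j=-\theta_j\theta_i$, $\theta_i^2=0$, $\theta$'s commute with $x$'s). A dotted composition is a finite sequence $\alpha=(\alpha_1,\dots,\alpha_l)$ with entries either positive integers (non-dotted) or dotted nonnegative integers $\dot0,\dot1,\dots$; $\eta_i=1$ if $\alpha_i$ dotted, else $0$. $M_\alpha=\sum_{i_1<\cdots<i_l}\theta_{i_1}^{\eta_1}\cdots\theta_{i_l}^{\eta_l}x_{i_1}^{\alpha_1}\cdots x_{i_l}^{\alpha_l}$. The order $\preccurlyeq$ is the reflexive–transitive closure of: $\beta\preccurlyeq\alpha$ if $\alpha$ is obtained from $\beta$ by replacing two adjacent non-dotted parts by their sum; $L_\alpha=\sum_{\beta\preccurlyeq\alpha}M_\beta$. A dotted permutation is a finite sequence $w=[w_1,\dots,w_n]$ (size $n$) whose entries are either integers (non-dotted) or dotted nonnegative integers $\dot a$, the non-dotted entries being pairwise distinct.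 Let $w^\circ=(w^\circ_1,\dots,w^\circ_N)$ be the subsequence of non-dotted entries. An index $i\in\{1,\dots,N\}$ is a descent of $w$ if $i<N$ and $w^\circ_i>w^\circ_{i+1}$, or if the entry of $w$ immediately after $w^\circ_i$ is dotted. If $d_1<\dots<d_k$ are the descents (set $d_0=0$), $\mathrm{comp}(w)$ is the dotted composition whose non-dotted parts are, in order, $d_1-d_0,d_2-d_1,\dots,d_k-d_{k-1},N-d_k$ (the last one omitted if it equals $0$), and whose dotted parts are the dotted entries of $w$ (with their values), inserted as follows: dotted entries of $w$ preceding all non-dotted entries are placed at the beginning, in order; the maximal run of consecutive dotted entries immediately following $w^\circ_{d_j}$ in $w$ is inserted, in order, right after the part $d_j-d_{j-1}$. A dotted permutation $w$ represents $\alpha$ on $S$ if $\mathrm{comp}(w)=\alpha$ and $w^\circ$ is an arrangement of the elements of $S$. Grid and paths: let $p=\mathrm{size}(w_\alpha)$, $q=\mathrm{size}(w_\beta)$. Label column $j$ ($1\le j\le p$, left to right) of a $p\times q$ grid by $(w_\alpha)_j$ and row $i$ ($1\le i\le q$, bottom to top) by $(w_\beta)_i$. A fundamental path is a sequence of lattice points from $(0,0)$ to $(p,q)$ where from $(x,y)$ the allowed steps are: (1) to $(x+1,y)$; (2) to $(x,y+1)$; (3) if $(w_\alpha)_{x+1}$ is dotted and, for some $k\ge1$, $(w_\beta)_{y+1},\dots,(w_\beta)_{y+k}$ are all non-dotted with $(w_\beta)_{y+1}<\cdots<(w_\beta)_{y+k}$, to $(x+1,y+k)$; (4) if $(w_\beta)_{y+1}$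 is dotted and, for some $k\ge1$, $(w_\alpha)_{x+1},\dots,(w_\alpha)_{x+k}$ are all non-dotted with $(w_\alpha)_{x+1}<\cdots<(w_\alpha)_{x+k}$, to $(x+k,y+1)$. The dotted permutation $\Pi(P)$ is built by reading the steps in order and appending: for step (1), $(w_\alpha)_{x+1}$; for (2), $(w_\beta)_{y+1}$; for (3) with $(w_\alpha)_{x+1}=\dot a$, the dotted entry $\dot{(a+k)}$; for (4) with $(w_\beta)_{y+1}=\dot b$, the dotted entry $\dot{(b+k)}$. Put a dot in the cell in column $j$ and row $i$ whenever both $(w_\alpha)_j$ and $(w_\beta)_i$ are dotted; $\operatorname{sign}(P)=(-1)^{d}$ where $d$ is the number of such dotted cells lying below the path $P$ (between $P$ and the horizontal axis). -}

module Defs where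

open import Data.Bool using (Bool; true; false; _∨_; if_then_else_)
open import Data.Nat as ℕ using (ℕ; zero; suc)
open import Data.Integer as ℤ using (ℤ; +_; -_; _<?_)
open import Data.List using (List; []; _∷_; _++_; map; concatMap; drop; length; upTo; foldr)
open import Data.Vec as Vec using (Vec; []; _∷_)
import Data.Vec.Properties as VecP
import Data.Bool.Properties as BoolP
import Data.Nat.Properties as NatP
open import Data.Product using (_×_; _,_; proj₁; proj₂)
open import Data.Product.Properties using (≡-dec)
open import Relation.Nullary using (does; Dec)
open import Relation.Binary.PropositionalEquality using (_≡_)
open import Data.List.Relation.Unary.All using (All)
open import Data.List.Relation.Unary.Unique.Propositional using (Unique)
open import Data.List.Relation.Binary.Permutation.Propositional using (_↭_)

-- nd k : non-dotted part k ;  dt a : dotted part ȧ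
data Part : Set where
  nd : ℕ → Part
  dt : ℕ → Part

DComp : Set
DComp = List Part

data ValidPart : Part → Set where
  nd-valid : ∀ k → ValidPart (nd (suc k))
  dt-valid : ∀ a → ValidPart (dt a)

IsDottedComposition : DComp → Set
IsDottedComposition α = All ValidPart α

-- Superpolynomials in x₁..xₙ, θ₁..θₙ with integer coefficients.
-- A monomial θ_{i₁}⋯θ_{i_r} x^a (i₁<⋯<i_r) is stored as (θ-support, exponents),
-- index 0 of the vectors being variable 1.

Mono : ℕ → Set
Mono n = Vec Bool n × Vec ℕ n

_≟M_ : ∀ {n} (m m' : Mono n) → Dec (m ≡ m')
_≟M_ = ≡-dec (VecP.≡-dec BoolP._≟_) (VecP.≡-dec NatP._≟_)

Poly : ℕ → Set
Poly n = List (ℤ × Mono n)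

coeff : ∀ {n} → Poly n → Mono n → ℤ
coeff [] m = + 0
coeff ((c , m') ∷ p) m = if does (m' ≟M m) then c ℤ.+ coeff p m else coeff p m

_≈P_ : ∀ {n} → Poly n → Poly n → Set
p ≈P q = ∀ m → coeff p m ≡ coeff q m

infix 4 _≈P_

_+P_ : ∀ {n} → Poly n → Poly n → Poly n
p +P q = p ++ q

_·P_ : ∀ {n} → ℤ → Poly n → Poly n
c ·P p = map (λ t → c ℤ.* proj₁ t , proj₂ t) p

ΣP : ∀ {n} → List (Poly n) → Poly n
ΣP = foldr _+P_ []

countTrue : ∀ {n} → Vec Bool n → ℕ
countTrue [] = 0
countTrue (true ∷ v) = suc (countTrue v)
countTrue (false ∷ v) = countTrue v

-- θ_A θ_B = sgnθ A B · θ_{A∪B} (both products in increasing index order);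
-- 0 if A ∩ B ≠ ∅, otherwise (-1)^#{(a,b) ∈ A×B : a > b}
sgnθ : ∀ {n} → Vec Bool n → Vec Bool n → ℤ
sgnθ [] [] = + 1
sgnθ (true ∷ A) (true ∷ B) = + 0
sgnθ (false ∷ A) (true ∷ B) = ((- + 1) ℤ.^ countTrue A) ℤ.* sgnθ A B
sgnθ (a ∷ A) (false ∷ B) = sgnθ A B

mulMono : ∀ {n} → Mono n → Mono n → ℤ × Mono n
mulMono (A , a) (B , b) = sgnθ A B , (Vec.zipWith _∨_ A B , Vec.zipWith ℕ._+_ a b)

_*P_ : ∀ {n} → Poly n → Poly n → Poly n
p *P q = concatMap (λ t → map (λ u → let r = mulMono (proj₂ t) (proj₂ u)
                                      in proj₁ t ℤ.* proj₁ u ℤ.* proj₁ r , proj₂ r) q) p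

consPart : ∀ {n} → Part → Mono n → Mono (suc n)
consPart (nd k) (A , a) = false ∷ A , k ∷ a
consPart (dt k) (A , a) = true ∷ A , k ∷ a

consUnused : ∀ {n} → Mono n → Mono (suc n)
consUnused (A , a) = false ∷ A , 0 ∷ a

emptyMono : Mono 0
emptyMono = [] , []

-- M_α(x₁..xₙ, θ₁..θₙ) = Σ_{i₁<⋯<i_l ≤ n} θ_{i₁}^{η₁}⋯θ_{i_l}^{η_l} x_{i₁}^{α₁}⋯x_{i_l}^{α_l}
-- (recursion on the smallest variable, which is either unused or equals i₁)
M : (n : ℕ) → DComp → Poly n
M zero [] = (+ 1 , emptyMono) ∷ []
M zero (p ∷ α) = []
M (suc n) [] = map (λ t → proj₁ t , consUnused (proj₂ t)) (M n [])
M (suc n) (p ∷ α) =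
  map (λ t → proj₁ t , consPart p (proj₂ t)) (M n α)
  ++ map (λ t → proj₁ t , consUnused (proj₂ t)) (M n (p ∷ α))

bump : List ℕ → List ℕ
bump [] = []
bump (h ∷ t) = suc h ∷ t

compositions : ℕ → List (List ℕ)
compositions zero = []
compositions (suc zero) = (1 ∷ []) ∷ []
compositions (suc (suc k)) = concatMap (λ c → (1 ∷ c) ∷ bump c ∷ []) (compositions (suc k))

-- all β with β ≼ α : obtained from α by splitting each non-dotted part
-- into a composition of it (the inverse of merging adjacent non-dotted parts)
refinements : DComp → List DComp
refinements [] = [] ∷ []
refinements (dt a ∷ α) = map (dt a ∷_) (refinements α)
refinements (nd k ∷ α) =
  concatMap (λ c → map (λ r → map nd c ++ r) (refinements α)) (compositions k)

L : (n : ℕ) → DComp → Poly n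
L n α = ΣP (map (M n) (refinements α))

-- int z : non-dotted entry z ; dot a : dotted entry ȧ
data Entry : Set where
  int : ℤ → Entry
  dot : ℕ → Entry

DPerm : Set
DPerm = List Entry

nonDotted : DPerm → List ℤ
nonDotted [] = []
nonDotted (int z ∷ w) = z ∷ nonDotted w
nonDotted (dot a ∷ w) = nonDotted w

IsDottedPermutation : DPerm → Set
IsDottedPermutation w = Unique (nonDotted w)

-- comp(w).  `run c w` processes w starting at a non-dotted entry, c being the
-- number of non-dotted entries since the last descent; a descent occurs after a
-- non-dotted entry followed by a dotted entry, or by a smaller non-dotted entry.
mutual
  run : ℕ → DPerm → DComp
  run zero [] = []
  run (suc c) [] = nd (suc c) ∷ []
  run c (int e ∷ []) = nd (suc c) ∷ []
  run c (int e ∷ dot a ∷ r) = nd (suc c) ∷ dots (dot a ∷ r)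
  run c (int e ∷ int e' ∷ r) =
    if does (e' <? e) then nd (suc c) ∷ run 0 (int e' ∷ r) else run (suc c) (int e' ∷ r)
  run c (dot a ∷ r) = dt a ∷ run c r   -- not reached from comp

  dots : DPerm → DComp
  dots (dot a ∷ r) = dt a ∷ dots r
  dots r = run 0 r

comp : DPerm → DComp
comp w = dots w

Represents : DPerm → DComp → List ℤ → Set
Represents w α S = comp w ≡ α × nonDotted w ↭ S

-- right : step (1) ; up : step (2) ;
-- diagR k : step (3) to (x+1,y+k) ; diagU k : step (4) to (x+k,y+1)
data Step : Set where
  right up : Step
  diagR diagU : ℕ → Step

incRun : DPerm → ℕ
incRun [] = 0
incRun (dot a ∷ w) = 0
incRun (int e ∷ []) = 1
incRun (int e ∷ dot a ∷ w) = 1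
incRun (int e ∷ int e' ∷ w) = if does (e <? e') then suc (incRun (int e' ∷ w)) else 1

oneTo : ℕ → List ℕ
oneTo k = map suc (upTo k)

-- all fundamental paths from the current point to (p,q), where the
-- list arguments are the column labels still to the right (w_α)_{x+1},…
-- and the row labels still above (w_β)_{y+1},…
-- (`fuel` only serves termination: it is initialised to the total number of
-- remaining labels, and every step consumes at least one label)
pathsF : ℕ → DPerm → DPerm → List (List Step)
pathsF _ [] [] = [] ∷ []
pathsF zero _ _ = []
pathsF (suc f) [] (b ∷ bs) = map (up ∷_) (pathsF f [] bs)
pathsF (suc f) (a ∷ as) [] = map (right ∷_) (pathsF f as [])
pathsF (suc f) (int a ∷ as) (int b ∷ bs) =
  map (right ∷_) (pathsF f as (int b ∷ bs)) ++ map (up ∷_) (pathsF f (int a ∷ as) bs)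
pathsF (suc f) (dot a ∷ as) (int b ∷ bs) =
  map (right ∷_) (pathsF f as (int b ∷ bs)) ++ map (up ∷_) (pathsF f (dot a ∷ as) bs)
  ++ concatMap (λ k → map (diagR k ∷_) (pathsF f as (drop k (int b ∷ bs))))
               (oneTo (incRun (int b ∷ bs)))
pathsF (suc f) (int a ∷ as) (dot b ∷ bs) =
  map (right ∷_) (pathsF f as (dot b ∷ bs)) ++ map (up ∷_) (pathsF f (int a ∷ as) bs)
  ++ concatMap (λ k → map (diagU k ∷_) (pathsF f (drop k (int a ∷ as)) bs))
               (oneTo (incRun (int a ∷ as)))
pathsF (suc f) (dot a ∷ as) (dot b ∷ bs) =
  map (right ∷_) (pathsF f as (dot b ∷ bs)) ++ map (up ∷_) (pathsF f (dot a ∷ as) bs)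

paths : DPerm → DPerm → List (List Step)
paths wα wβ = pathsF (length wα ℕ.+ length wβ) wα wβ

isDot : Entry → ℕ
isDot (int _) = 0
isDot (dot _) = 1

-- Walk along a path: returns (Π(P), d) where d is the number of dotted cells
-- below P.  `e` counts dotted row labels (w_β)_1..(w_β)_y passed so far; when the
-- path crosses a dotted column at height y (by step (1) or (3)), exactly the
-- dotted cells of that column in rows 1..y lie below it (the cells crossed by a
-- diagonal step lie in non-dotted rows/columns, hence are not dotted).
walk : DPerm → DPerm → ℕ → List Step → DPerm × ℕ
walk as bs e [] = [] , 0
walk (a ∷ as) bs e (right ∷ P) =
  let r = walk as bs e P in a ∷ proj₁ r , isDot a ℕ.* e ℕ.+ proj₂ r
walk as (b ∷ bs) e (up ∷ P) =
  let r = walk as bs (isDot b ℕ.+ e) P in b ∷ proj₁ r , proj₂ r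
walk (dot a ∷ as) bs e (diagR k ∷ P) =
  let r = walk as (drop k bs) e P in dot (a ℕ.+ k) ∷ proj₁ r , e ℕ.+ proj₂ r
walk as (dot b ∷ bs) e (diagU k ∷ P) =
  let r = walk (drop k as) bs (suc e) P in dot (b ℕ.+ k) ∷ proj₁ r , proj₂ r
walk as bs e (s ∷ P) = [] , 0   -- invalid step; never reached on fundamental paths

Π : DPerm → DPerm → List Step → DPerm
Π wα wβ P = proj₁ (walk wα wβ 0 P)

sign : DPerm → DPerm → List Step → ℤ
sign wα wβ P = (- + 1) ℤ.^ proj₂ (walk wα wβ 0 P)

{-# OPTIONS --safe #-}
-- Both sides are expanded in the first variable and compared by induction on the number n of
-- variables. Lᵂ n w computes L_{comp w}(x₁, …, xₙ) from w: its monomials without θ₁ give x₁ to an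
-- ascending run of leading non-dotted entries of w, those with θ₁ give θ₁x₁ᵃ to a leading dotted
-- entry ȧ. A fundamental path is split in the same way, according to whether the first entry of
-- Π(P) comes from the first column or the first row. As S lies below T, an ascending run of Π(P)
-- is a run of w_α followed by a run of w_β, matching the product of the θ₁-free parts; a dotted
-- entry ȧ of one word absorbing a run of k entries of the other is the diagonal step producing
-- the dotted entry a+k, and moving θ₁ past the θ's of the other factor produces the sign of the
-- dotted cells below the path. The remaining products contain θ₁² = 0.
module Submission where

open import Defs
open import Data.Bool as Bool using (Bool; true; false; if_then_else_)
open import Data.Nat as ℕ using (ℕ; zero; suc; _≤_; z≤n; s≤s)
import Data.Nat.Properties as ℕ
open import Data.Integer as ℤ using (ℤ; +_; _+_; _*_; _^_; _<_; _<?_; -1ℤ; 0ℤ; 1ℤ)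
import Data.Integer.Properties as ℤ
open import Data.Integer.Tactic.RingSolver using (solve-∀)
open import Data.List using (List; []; _∷_; _++_; map; concatMap; drop; length)
import Data.List.Properties as List
open import Data.List.Membership.Propositional using (_∈_)
open import Data.List.Relation.Unary.All as All using (All; []; _∷_)
import Data.List.Relation.Unary.All.Properties as All
open import Data.List.Relation.Unary.Any using (here; there)
open import Data.List.Relation.Unary.Unique.Propositional using (Unique)
import Data.List.Relation.Unary.Unique.Propositional.Properties as Unique
import Data.List.Relation.Unary.AllPairs as AllPairs
open import Data.List.Relation.Binary.Permutation.Propositional.Properties using (∈-resp-↭)
open import Data.Vec using (_∷_)
open import Data.Maybe using (Maybe; just; nothing)
open import Data.Product using (Σ; _×_; _,_; proj₁; proj₂; map₂)
open import Function using (_∘_)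
open import Data.Empty using (⊥-elim)
open import Data.Unit using (⊤)
open import Relation.Binary using (Setoid; tri<; tri≈; tri>)
open import Relation.Binary.PropositionalEquality
open import Relation.Nullary using (¬_; Dec; yes; no; does)
open import Relation.Nullary.Decidable using (dec-true; dec-false)

private
  variable
    n : ℕ
    I I′ : Set

infix 4 _≋_
record _≋_ {n} (p q : Poly n) : Set where
  constructor mk≋
  field coeff-≡ : ∀ m → coeff p m ≡ coeff q m
open _≋_

≋-refl : ∀ {p : Poly n} → p ≋ p
≋-refl = mk≋ λ _ → refl

≋-sym : ∀ {p q : Poly n} → p ≋ q → q ≋ p
≋-sym p≋q = mk≋ λ m → sym (coeff-≡ p≋q m)

≋-trans : ∀ {p q r : Poly n} → p ≋ q → q ≋ r → p ≋ r
≋-trans p≋q q≋r = mk≋ λ m → trans (coeff-≡ p≋q m) (coeff-≡ q≋r m)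

≋-setoid : ℕ → Setoid _ _
≋-setoid n = record
  { Carrier = Poly n
  ; _≈_ = _≋_
  ; isEquivalence = record { refl = ≋-refl ; sym = ≋-sym ; trans = ≋-trans }
  }

module ≋-Reasoning {n : ℕ} where
  open import Relation.Binary.Reasoning.Setoid (≋-setoid n) public

≡⇒≋ : ∀ {p q : Poly n} → p ≡ q → p ≋ q
≡⇒≋ refl = ≋-refl

infix 25 -1^_
-1^_ : ℕ → ℤ
-1^ d = -1ℤ ^ d

-1^-+ : ∀ a b → -1^ (a ℕ.+ b) ≡ -1^ a * -1^ b
-1^-+ = ℤ.^-distribˡ-+-* -1ℤ

coeff-++ : ∀ (p q : Poly n) m → coeff (p ++ q) m ≡ coeff p m + coeff q m
coeff-++ [] q m = sym (ℤ.+-identityˡ _)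
coeff-++ ((c , m′) ∷ p) q m with does (m′ ≟M m)
... | true  = trans (cong (λ x → c + x) (coeff-++ p q m)) (sym (ℤ.+-assoc c _ _))
... | false = coeff-++ p q m

coeff-· : ∀ c (p : Poly n) m → coeff (c ·P p) m ≡ c * coeff p m
coeff-· c [] m = sym (ℤ.*-zeroʳ c)
coeff-· c ((d , m′) ∷ p) m with does (m′ ≟M m)
... | true  = trans (cong (λ x → c * d + x) (coeff-· c p m)) (sym (ℤ.*-distribˡ-+ c d _))
... | false = coeff-· c p m

++-cong : ∀ {p p′ q q′ : Poly n} → p ≋ p′ → q ≋ q′ → p ++ q ≋ p′ ++ q′
++-cong {p = p} {p′} {q} {q′} p≋p′ q≋q′ = mk≋ λ m → begin
  coeff (p ++ q) m          ≡⟨ coeff-++ p q m ⟩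
  coeff p m + coeff q m     ≡⟨ cong₂ _+_ (coeff-≡ p≋p′ m) (coeff-≡ q≋q′ m) ⟩
  coeff p′ m + coeff q′ m   ≡⟨ coeff-++ p′ q′ m ⟨
  coeff (p′ ++ q′) m        ∎
  where open ≡-Reasoning

++-comm : ∀ (p q : Poly n) → p ++ q ≋ q ++ p
++-comm p q = mk≋ λ m → begin
  coeff (p ++ q) m       ≡⟨ coeff-++ p q m ⟩
  coeff p m + coeff q m  ≡⟨ ℤ.+-comm (coeff p m) (coeff q m) ⟩
  coeff q m + coeff p m  ≡⟨ coeff-++ q p m ⟨
  coeff (q ++ p) m       ∎
  where open ≡-Reasoning

++-interchange : ∀ (p q r s : Poly n) → (p ++ q) ++ (r ++ s) ≋ (p ++ r) ++ (q ++ s)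
++-interchange p q r s = begin
  (p ++ q) ++ (r ++ s)  ≡⟨ List.++-assoc p q (r ++ s) ⟩
  p ++ (q ++ (r ++ s))  ≡⟨ cong (p ++_) (List.++-assoc q r s) ⟨
  p ++ ((q ++ r) ++ s)  ≈⟨ ++-cong (≋-refl {p = p}) (++-cong (++-comm q r) ≋-refl) ⟩
  p ++ ((r ++ q) ++ s)  ≡⟨ cong (p ++_) (List.++-assoc r q s) ⟩
  p ++ (r ++ (q ++ s))  ≡⟨ List.++-assoc p r (q ++ s) ⟨
  (p ++ r) ++ (q ++ s)  ∎
  where open ≋-Reasoning

++-identityʳ : ∀ (p : Poly n) → p ++ [] ≋ p
++-identityʳ p = ≡⇒≋ (List.++-identityʳ p)

·-cong : ∀ c {p q : Poly n} → p ≋ q → c ·P p ≋ c ·P q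
·-cong c {p} {q} p≋q = mk≋ λ m → begin
  coeff (c ·P p) m  ≡⟨ coeff-· c p m ⟩
  c * coeff p m     ≡⟨ cong (c *_) (coeff-≡ p≋q m) ⟩
  c * coeff q m     ≡⟨ coeff-· c q m ⟨
  coeff (c ·P q) m  ∎
  where open ≡-Reasoning

·-distrib-++ : ∀ c (p q : Poly n) → c ·P (p ++ q) ≡ c ·P p ++ c ·P q
·-distrib-++ c = List.map-++ _

·-distrib-++₃ : ∀ c (p q r : Poly n) → c ·P (p ++ (q ++ r)) ≡ c ·P p ++ (c ·P q ++ c ·P r)
·-distrib-++₃ c p q r = trans (·-distrib-++ c p (q ++ r)) (cong (c ·P p ++_) (·-distrib-++ c q r))

·-assoc : ∀ c d (p : Poly n) → c ·P (d ·P p) ≡ (c * d) ·P p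
·-assoc c d [] = refl
·-assoc c d ((x , m) ∷ p) = cong₂ _∷_ (cong (_, m) (sym (ℤ.*-assoc c d x))) (·-assoc c d p)

·-identityˡ : ∀ (p : Poly n) → 1ℤ ·P p ≡ p
·-identityˡ [] = refl
·-identityˡ ((x , m) ∷ p) = cong₂ _∷_ (cong (_, m) (ℤ.*-identityˡ x)) (·-identityˡ p)

∑ : List I → (I → Poly n) → Poly n
∑ xs f = ΣP (map f xs)

infix 6 ∑
syntax ∑ xs (λ x → t) = ∑[ x ∈ xs ] t

∑-++ : (xs ys : List I) (f : I → Poly n) → ∑ (xs ++ ys) f ≡ ∑ xs f ++ ∑ ys f
∑-++ [] ys f = refl
∑-++ (x ∷ xs) ys f = trans (cong (f x ++_) (∑-++ xs ys f)) (sym (List.++-assoc (f x) _ _))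

∑-map : (g : I → I′) (xs : List I) (f : I′ → Poly n) → ∑ (map g xs) f ≡ ∑ xs (f ∘ g)
∑-map g xs f = cong ΣP (sym (List.map-∘ xs))

∑-concatMap : (g : I → List I′) (xs : List I) (f : I′ → Poly n) →
  ∑ (concatMap g xs) f ≡ ∑[ x ∈ xs ] ∑ (g x) f
∑-concatMap g [] f = refl
∑-concatMap g (x ∷ xs) f = trans (∑-++ (g x) _ f) (cong (∑ (g x) f ++_) (∑-concatMap g xs f))

∑-cong-∈ : (xs : List I) {f g : I → Poly n} → (∀ {x} → x ∈ xs → f x ≋ g x) → ∑ xs f ≋ ∑ xs g
∑-cong-∈ [] f≋g = ≋-refl
∑-cong-∈ (x ∷ xs) f≋g = ++-cong (f≋g (here refl)) (∑-cong-∈ xs (f≋g ∘ there))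

∑-cong : (xs : List I) {f g : I → Poly n} → (∀ x → f x ≋ g x) → ∑ xs f ≋ ∑ xs g
∑-cong xs f≋g = ∑-cong-∈ xs λ {x} _ → f≋g x

∑-≡-∈ : (xs : List I) {f g : I → Poly n} → (∀ {x} → x ∈ xs → f x ≡ g x) → ∑ xs f ≡ ∑ xs g
∑-≡-∈ [] f≡g = refl
∑-≡-∈ (x ∷ xs) f≡g = cong₂ _++_ (f≡g (here refl)) (∑-≡-∈ xs (f≡g ∘ there))

∑-≡ : (xs : List I) {f g : I → Poly n} → (∀ x → f x ≡ g x) → ∑ xs f ≡ ∑ xs g
∑-≡ xs f≡g = ∑-≡-∈ xs λ {x} _ → f≡g x

∑-zero : (xs : List I) → ∑[ x ∈ xs ] [] {A = ℤ × Mono n} ≡ []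
∑-zero [] = refl
∑-zero (x ∷ xs) = ∑-zero xs

∑-vanishing : (xs : List I) {f : I → Poly n} → (∀ x → f x ≋ []) → ∑ xs f ≋ []
∑-vanishing xs f≋[] = ≋-trans (∑-cong xs f≋[]) (≡⇒≋ (∑-zero xs))

∑-· : ∀ c (xs : List I) (f : I → Poly n) → ∑[ x ∈ xs ] c ·P f x ≡ c ·P ∑ xs f
∑-· c [] f = refl
∑-· c (x ∷ xs) f = trans (cong (c ·P f x ++_) (∑-· c xs f)) (sym (·-distrib-++ c (f x) _))

∑-++-distrib : (xs : List I) (f g : I → Poly n) → ∑[ x ∈ xs ] (f x ++ g x) ≋ ∑ xs f ++ ∑ xs g
∑-++-distrib [] f g = ≋-refl
∑-++-distrib (x ∷ xs) f g =
  ≋-trans (++-cong (≋-refl {p = f x ++ g x}) (∑-++-distrib xs f g)) (++-interchange (f x) (g x) _ _)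

infixr 7 _·ᵗ_
_·ᵗ_ : ℤ × Mono n → Poly n → Poly n
t ·ᵗ q = map (λ u → let r = mulMono (proj₂ t) (proj₂ u) in proj₁ t * proj₁ u * proj₁ r , proj₂ r) q

*-zeroʳ : ∀ (p : Poly n) → p *P [] ≡ []
*-zeroʳ [] = refl
*-zeroʳ (t ∷ p) = *-zeroʳ p

·-zeroʳ-* : ∀ c (p : Poly n) → c ·P (p *P []) ≋ []
·-zeroʳ-* c p = ≡⇒≋ (cong (c ·P_) (*-zeroʳ p))

*-distribʳ-++ : ∀ (p q r : Poly n) → (p ++ q) *P r ≡ p *P r ++ q *P r
*-distribʳ-++ p q r = List.concatMap-++ (_·ᵗ r) p q

*-distribˡ-++ : ∀ (p q r : Poly n) → p *P (q ++ r) ≋ p *P q ++ p *P r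
*-distribˡ-++ [] q r = ≋-refl
*-distribˡ-++ (t ∷ p) q r = begin
  t ·ᵗ (q ++ r) ++ p *P (q ++ r)           ≡⟨ cong (_++ p *P (q ++ r)) (List.map-++ _ q r) ⟩
  (t ·ᵗ q ++ t ·ᵗ r) ++ p *P (q ++ r)      ≈⟨ ++-cong ≋-refl (*-distribˡ-++ p q r) ⟩
  (t ·ᵗ q ++ t ·ᵗ r) ++ (p *P q ++ p *P r) ≈⟨ ++-interchange (t ·ᵗ q) (t ·ᵗ r) _ _ ⟩
  (t ·ᵗ q ++ p *P q) ++ (t ·ᵗ r ++ p *P r) ∎
  where open ≋-Reasoning

*-expand : ∀ (p q r s : Poly n) → (p ++ q) *P (r ++ s) ≋ (p *P r ++ p *P s) ++ (q *P r ++ q *P s)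
*-expand p q r s = begin
  (p ++ q) *P (r ++ s)                       ≡⟨ *-distribʳ-++ p q (r ++ s) ⟩
  p *P (r ++ s) ++ q *P (r ++ s)             ≈⟨ ++-cong (*-distribˡ-++ p r s) (*-distribˡ-++ q r s) ⟩
  (p *P r ++ p *P s) ++ (q *P r ++ q *P s)   ∎
  where open ≋-Reasoning

-- Both factors of p *P q enter coeff (p *P q) m through functionals of this form, which respect ≋.
lin : (Mono n → ℤ) → Poly n → ℤ
lin G [] = 0ℤ
lin G ((c , m) ∷ p) = c * G m + lin G p

lin-++ : ∀ (G : Mono n → ℤ) p q → lin G (p ++ q) ≡ lin G p + lin G q
lin-++ G [] q = sym (ℤ.+-identityˡ _)
lin-++ G ((c , m) ∷ p) q = trans (cong (λ x → c * G m + x) (lin-++ G p q)) (sym (ℤ.+-assoc (c * G m) _ _))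

lin-· : ∀ (G : Mono n → ℤ) a p → lin G (a ·P p) ≡ a * lin G p
lin-· G a [] = sym (ℤ.*-zeroʳ a)
lin-· G a ((c , m) ∷ p) = begin
  a * c * G m + lin G (a ·P p)   ≡⟨ cong (λ x → a * c * G m + x) (lin-· G a p) ⟩
  a * c * G m + a * lin G p      ≡⟨ distrib a c (G m) (lin G p) ⟩
  a * (c * G m + lin G p)        ∎
  where
  open ≡-Reasoning
  distrib : ∀ a c g l → a * c * g + a * l ≡ a * (c * g + l)
  distrib = solve-∀

remove : Mono n → Poly n → Poly n
remove m₀ [] = []
remove m₀ ((c , m) ∷ p) = if does (m ≟M m₀) then remove m₀ p else (c , m) ∷ remove m₀ p

lin-remove : ∀ (G : Mono n → ℤ) m₀ p → lin G p ≡ coeff p m₀ * G m₀ + lin G (remove m₀ p)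
lin-remove G m₀ [] = sym (ℤ.+-identityʳ _)
lin-remove G m₀ ((c , m) ∷ p) with m ≟M m₀
... | yes refl = trans (cong (λ x → c * G m + x) (lin-remove G m p)) (sym (regroup c (G m) (coeff p m) _))
  where
  regroup : ∀ c g x l → (c + x) * g + l ≡ c * g + (x * g + l)
  regroup = solve-∀
... | no _ = trans (cong (λ x → c * G m + x) (lin-remove G m₀ p)) (sym (regroup c (G m₀) (coeff p m₀) _ (G m)))
  where
  regroup : ∀ c g x l y → x * g + (c * y + l) ≡ c * y + (x * g + l)
  regroup = solve-∀

coeff-remove-same : ∀ (p : Poly n) m₀ → coeff (remove m₀ p) m₀ ≡ 0ℤ
coeff-remove-same [] m₀ = refl
coeff-remove-same ((c , m) ∷ p) m₀ with m ≟M m₀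
... | yes refl = coeff-remove-same p m
... | no m≢m₀ rewrite dec-false (m ≟M m₀) m≢m₀ = coeff-remove-same p m₀

coeff-remove-other : ∀ (p : Poly n) {m₀ m} → ¬ m ≡ m₀ → coeff (remove m₀ p) m ≡ coeff p m
coeff-remove-other [] m≢m₀ = refl
coeff-remove-other ((c , m′) ∷ p) {m₀} {m} m≢m₀ with m′ ≟M m₀
... | yes refl rewrite dec-false (m′ ≟M m) (m≢m₀ ∘ sym) = coeff-remove-other p m≢m₀
... | no _ with does (m′ ≟M m)
...   | true  = cong (λ x → c + x) (coeff-remove-other p m≢m₀)
...   | false = coeff-remove-other p m≢m₀

length-remove : ∀ (p : Poly n) m₀ → length (remove m₀ p) ≤ length p
length-remove [] m₀ = z≤n
length-remove ((c , m) ∷ p) m₀ with does (m ≟M m₀)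
... | true  = ℕ.m≤n⇒m≤1+n (length-remove p m₀)
... | false = s≤s (length-remove p m₀)

lin-vanishing : ∀ (G : Mono n → ℤ) k (p : Poly n) → length p ≤ k → (∀ m → coeff p m ≡ 0ℤ) →
  lin G p ≡ 0ℤ
lin-vanishing G k [] _ _ = refl
lin-vanishing G (suc k) ((c , m₀) ∷ p) (s≤s ∣p∣≤k) p≋0 = begin
  lin G ((c , m₀) ∷ p)
    ≡⟨ lin-remove G m₀ ((c , m₀) ∷ p) ⟩
  coeff ((c , m₀) ∷ p) m₀ * G m₀ + lin G (remove m₀ ((c , m₀) ∷ p))
    ≡⟨ cong₂ (λ x y → x * G m₀ + lin G y) (p≋0 m₀) removed-head ⟩
  0ℤ * G m₀ + lin G (remove m₀ p)
    ≡⟨ cong₂ _+_ (ℤ.*-zeroˡ (G m₀)) (lin-vanishing G k (remove m₀ p) ∣p′∣≤k p′≋0) ⟩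
  0ℤ ∎
  where
  open ≡-Reasoning
  removed-head : remove m₀ ((c , m₀) ∷ p) ≡ remove m₀ p
  removed-head rewrite dec-true (m₀ ≟M m₀) refl = refl
  ∣p′∣≤k : length (remove m₀ p) ≤ k
  ∣p′∣≤k = ℕ.≤-trans (length-remove p m₀) ∣p∣≤k
  p′≋0 : ∀ m → coeff (remove m₀ p) m ≡ 0ℤ
  p′≋0 m with m ≟M m₀
  ... | yes refl = coeff-remove-same p m
  ... | no m≢m₀ = begin
    coeff (remove m₀ p) m   ≡⟨ coeff-remove-other p m≢m₀ ⟩
    coeff p m               ≡⟨ cong (λ b → if b then c + coeff p m else coeff p m)
                                    (dec-false (m₀ ≟M m) (m≢m₀ ∘ sym)) ⟨
    coeff ((c , m₀) ∷ p) m  ≡⟨ p≋0 m ⟩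
    0ℤ                      ∎

lin-cong : ∀ (G : Mono n → ℤ) {p q : Poly n} → p ≋ q → lin G p ≡ lin G q
lin-cong G {p} {q} p≋q = begin
  lin G p                               ≡⟨ add-and-subtract (lin G p) (lin G q) ⟩
  lin G p + -1ℤ * lin G q + lin G q     ≡⟨ cong (λ x → lin G p + x + lin G q) (lin-· G -1ℤ q) ⟨
  lin G p + lin G (-1ℤ ·P q) + lin G q  ≡⟨ cong (_+ lin G q) (lin-++ G p (-1ℤ ·P q)) ⟨
  lin G (p ++ -1ℤ ·P q) + lin G q
    ≡⟨ cong (_+ lin G q) (lin-vanishing G _ (p ++ -1ℤ ·P q) ℕ.≤-refl difference-vanishes) ⟩
  0ℤ + lin G q                          ≡⟨ ℤ.+-identityˡ _ ⟩
  lin G q                               ∎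
  where
  open ≡-Reasoning
  add-and-subtract : ∀ x y → x ≡ x + -1ℤ * y + y
  add-and-subtract = solve-∀
  difference-vanishes : ∀ m → coeff (p ++ -1ℤ ·P q) m ≡ 0ℤ
  difference-vanishes m = begin
    coeff (p ++ -1ℤ ·P q) m           ≡⟨ coeff-++ p _ m ⟩
    coeff p m + coeff (-1ℤ ·P q) m    ≡⟨ cong₂ _+_ (coeff-≡ p≋q m) (coeff-· -1ℤ q m) ⟩
    coeff q m + -1ℤ * coeff q m       ≡⟨ cancel (coeff q m) ⟩
    0ℤ                                ∎
    where
    cancel : ∀ x → x + -1ℤ * x ≡ 0ℤ
    cancel = solve-∀

·ᵗ-unit : ∀ c (m : Mono n) q → (c , m) ·ᵗ q ≡ c ·P ((1ℤ , m) ·ᵗ q)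
·ᵗ-unit c m [] = refl
·ᵗ-unit c m (u ∷ q) = cong₂ _∷_ (cong (_, _) (reassoc c (proj₁ u) _)) (·ᵗ-unit c m q)
  where
  reassoc : ∀ c a s → c * a * s ≡ c * (1ℤ * a * s)
  reassoc = solve-∀

coeff-*ˡ : ∀ (p q : Poly n) m → coeff (p *P q) m ≡ lin (λ m′ → coeff ((1ℤ , m′) ·ᵗ q) m) p
coeff-*ˡ [] q m = refl
coeff-*ˡ ((c , m′) ∷ p) q m = begin
  coeff ((c , m′) ·ᵗ q ++ p *P q) m
    ≡⟨ coeff-++ ((c , m′) ·ᵗ q) (p *P q) m ⟩
  coeff ((c , m′) ·ᵗ q) m + coeff (p *P q) m
    ≡⟨ cong₂ _+_ (cong (λ r → coeff r m) (·ᵗ-unit c m′ q)) (coeff-*ˡ p q m) ⟩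
  coeff (c ·P ((1ℤ , m′) ·ᵗ q)) m + _
    ≡⟨ cong (_+ _) (coeff-· c ((1ℤ , m′) ·ᵗ q) m) ⟩
  c * coeff ((1ℤ , m′) ·ᵗ q) m + _ ∎
  where open ≡-Reasoning

coeff-·ᵗ : ∀ (t : ℤ × Mono n) q m →
  coeff (t ·ᵗ q) m
    ≡ lin (λ u → let r = mulMono (proj₂ t) u in if does (proj₂ r ≟M m) then proj₁ t * proj₁ r else 0ℤ) q
coeff-·ᵗ t [] m = refl
coeff-·ᵗ t ((c , u) ∷ q) m with does (proj₂ (mulMono (proj₂ t) u) ≟M m)
... | true  = cong₂ _+_ (reorder (proj₁ t) c _) (coeff-·ᵗ t q m)
  where
  reorder : ∀ a c s → a * c * s ≡ c * (a * s)
  reorder = solve-∀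
... | false = trans (coeff-·ᵗ t q m) (sym (trans (cong (_+ _) (ℤ.*-zeroʳ c)) (ℤ.+-identityˡ _)))

*-congˡ : ∀ {p p′ : Poly n} q → p ≋ p′ → p *P q ≋ p′ *P q
*-congˡ {p = p} {p′} q p≋p′ = mk≋ λ m →
  trans (coeff-*ˡ p q m) (trans (lin-cong _ p≋p′) (sym (coeff-*ˡ p′ q m)))

*-congʳ : ∀ (p : Poly n) {q q′ : Poly n} → q ≋ q′ → p *P q ≋ p *P q′
*-congʳ [] q≋q′ = ≋-refl
*-congʳ (t ∷ p) {q} {q′} q≋q′ = ++-cong
  (mk≋ λ m → trans (coeff-·ᵗ t q m) (trans (lin-cong _ q≋q′) (sym (coeff-·ᵗ t q′ m))))
  (*-congʳ p q≋q′)

*-cong : ∀ {p p′ q q′ : Poly n} → p ≋ p′ → q ≋ q′ → p *P q ≋ p′ *P q′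
*-cong {p′ = p′} {q = q} p≋p′ q≋q′ = ≋-trans (*-congˡ q p≋p′) (*-congʳ p′ q≋q′)

consᴹ : Bool → ℕ → Mono n → Mono (suc n)
consᴹ b k (A , a) = b ∷ A , k ∷ a

-- consᴾ b k p = θ₁^b x₁^k p(x₂, …, x_{n+1})
consᴾ : Bool → ℕ → Poly n → Poly (suc n)
consᴾ b k = map (λ t → proj₁ t , consᴹ b k (proj₂ t))

consᴹ-injective : ∀ {b b′ k k′} {m m′ : Mono n} →
  consᴹ b k m ≡ consᴹ b′ k′ m′ → b ≡ b′ × k ≡ k′ × m ≡ m′
consᴹ-injective {m = A , a} {A′ , a′} refl = refl , refl , refl

coeff-consᴾ-hit : ∀ b k (p : Poly n) m → coeff (consᴾ b k p) (consᴹ b k m) ≡ coeff p m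
coeff-consᴾ-hit b k [] m = refl
coeff-consᴾ-hit b k ((c , m′) ∷ p) m with m′ ≟M m
... | yes refl rewrite dec-true (consᴹ b k m ≟M consᴹ b k m) refl =
  cong (λ x → c + x) (coeff-consᴾ-hit b k p m)
... | no m′≢m
  rewrite dec-false (consᴹ b k m′ ≟M consᴹ b k m) (m′≢m ∘ proj₂ ∘ proj₂ ∘ consᴹ-injective) =
  coeff-consᴾ-hit b k p m

coeff-consᴾ-miss : ∀ {b k b′ k′} (p : Poly n) m → ¬ (b ≡ b′ × k ≡ k′) →
  coeff (consᴾ b k p) (consᴹ b′ k′ m) ≡ 0ℤ
coeff-consᴾ-miss [] m _ = refl
coeff-consᴾ-miss {b = b} {k} {b′} {k′} ((c , m′) ∷ p) m ≢
  rewrite dec-false (consᴹ b k m′ ≟M consᴹ b′ k′ m) (≢ ∘ map₂ proj₁ ∘ consᴹ-injective) =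
  coeff-consᴾ-miss p m ≢

consᴾ-cong : ∀ b k {p q : Poly n} → p ≋ q → consᴾ b k p ≋ consᴾ b k q
consᴾ-cong b k {p} {q} p≋q =
  mk≋ λ { (b′ ∷ A , k′ ∷ a) → coeff-at b′ k′ (A , a) (b Bool.≟ b′) (k ℕ.≟ k′) }
  where
  coeff-at : ∀ b′ k′ m → Dec (b ≡ b′) → Dec (k ≡ k′) →
    coeff (consᴾ b k p) (consᴹ b′ k′ m) ≡ coeff (consᴾ b k q) (consᴹ b′ k′ m)
  coeff-at _ _ m (yes refl) (yes refl) =
    trans (coeff-consᴾ-hit b k p m) (trans (coeff-≡ p≋q m) (sym (coeff-consᴾ-hit b k q m)))
  coeff-at _ _ m (no b≢b′) _ =
    trans (coeff-consᴾ-miss p m (b≢b′ ∘ proj₁)) (sym (coeff-consᴾ-miss q m (b≢b′ ∘ proj₁)))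
  coeff-at _ _ m _ (no k≢k′) =
    trans (coeff-consᴾ-miss p m (k≢k′ ∘ proj₂)) (sym (coeff-consᴾ-miss q m (k≢k′ ∘ proj₂)))

consᴾ-++ : ∀ b k (p q : Poly n) → consᴾ b k (p ++ q) ≡ consᴾ b k p ++ consᴾ b k q
consᴾ-++ b k = List.map-++ _

consᴾ-· : ∀ b k c (p : Poly n) → consᴾ b k (c ·P p) ≡ c ·P consᴾ b k p
consᴾ-· b k c p = trans (sym (List.map-∘ p)) (List.map-∘ p)

consᴾ-∑ : ∀ b k (xs : List I) (f : I → Poly n) →
  consᴾ b k (∑ xs f) ≡ ∑[ x ∈ xs ] consᴾ b k (f x)
consᴾ-∑ b k [] f = refl
consᴾ-∑ b k (x ∷ xs) f = trans (consᴾ-++ b k (f x) _) (cong (consᴾ b k (f x) ++_) (consᴾ-∑ b k xs f))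

HasθDegree : ℕ → Poly n → Set
HasθDegree d p = All (λ t → countTrue (proj₁ (proj₂ t)) ≡ d) p

consᴾ-false-θdegree : ∀ {d} k {p : Poly n} → HasθDegree d p → HasθDegree d (consᴾ false k p)
consᴾ-false-θdegree k [] = []
consᴾ-false-θdegree k (deg ∷ degs) = deg ∷ consᴾ-false-θdegree k degs

consᴾ-true-θdegree : ∀ {d} k {p : Poly n} → HasθDegree d p → HasθDegree (suc d) (consᴾ true k p)
consᴾ-true-θdegree k [] = []
consᴾ-true-θdegree k (deg ∷ degs) = cong suc deg ∷ consᴾ-true-θdegree k degs

consᴾ-*-consᴾ-false : ∀ b k l (p q : Poly n) →
  consᴾ b k p *P consᴾ false l q ≡ consᴾ b (k ℕ.+ l) (p *P q)
consᴾ-*-consᴾ-false b k l [] q = refl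
consᴾ-*-consᴾ-false b k l ((c , m) ∷ p) q = begin
  (c , consᴹ b k m) ·ᵗ consᴾ false l q ++ consᴾ b k p *P consᴾ false l q
    ≡⟨ cong₂ _++_ (term b q) (consᴾ-*-consᴾ-false b k l p q) ⟩
  consᴾ b (k ℕ.+ l) ((c , m) ·ᵗ q) ++ consᴾ b (k ℕ.+ l) (p *P q)
    ≡⟨ consᴾ-++ b (k ℕ.+ l) ((c , m) ·ᵗ q) (p *P q) ⟨
  consᴾ b (k ℕ.+ l) ((c , m) ·ᵗ q ++ p *P q) ∎
  where
  open ≡-Reasoning
  term : ∀ b q → (c , consᴹ b k m) ·ᵗ consᴾ false l q ≡ consᴾ b (k ℕ.+ l) ((c , m) ·ᵗ q)
  term b [] = refl
  term true  (u ∷ q) = cong (_ ∷_) (term true q)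
  term false (u ∷ q) = cong (_ ∷_) (term false q)

consᴾ-false-*-consᴾ-true : ∀ {d} k l {p : Poly n} (q : Poly n) → HasθDegree d p →
  consᴾ false k p *P consᴾ true l q ≡ -1^ d ·P consᴾ true (k ℕ.+ l) (p *P q)
consᴾ-false-*-consᴾ-true k l q [] = refl
consᴾ-false-*-consᴾ-true {d = d} k l {(c , m) ∷ p} q (refl ∷ degs) = begin
  (c , consᴹ false k m) ·ᵗ consᴾ true l q ++ consᴾ false k p *P consᴾ true l q
    ≡⟨ cong₂ _++_ (term q) (consᴾ-false-*-consᴾ-true k l q degs) ⟩
  -1^ d ·P consᴾ true (k ℕ.+ l) ((c , m) ·ᵗ q) ++ -1^ d ·P consᴾ true (k ℕ.+ l) (p *P q)
    ≡⟨ ·-distrib-++ (-1^ d) (consᴾ true (k ℕ.+ l) ((c , m) ·ᵗ q)) (consᴾ true (k ℕ.+ l) (p *P q)) ⟨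
  -1^ d ·P (consᴾ true (k ℕ.+ l) ((c , m) ·ᵗ q) ++ consᴾ true (k ℕ.+ l) (p *P q))
    ≡⟨ cong (-1^ d ·P_) (consᴾ-++ true (k ℕ.+ l) ((c , m) ·ᵗ q) (p *P q)) ⟨
  -1^ d ·P consᴾ true (k ℕ.+ l) ((c , m) ·ᵗ q ++ p *P q) ∎
  where
  open ≡-Reasoning
  reorder : ∀ c a s t → c * a * (s * t) ≡ s * (c * a * t)
  reorder = solve-∀
  term : ∀ q → (c , consᴹ false k m) ·ᵗ consᴾ true l q
             ≡ -1^ d ·P consᴾ true (k ℕ.+ l) ((c , m) ·ᵗ q)
  term [] = refl
  term (u ∷ q) = cong₂ _∷_ (cong (_, _) (reorder c (proj₁ u) (-1^ d) _)) (term q)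

consᴾ-true-*-consᴾ-true : ∀ k l (p q : Poly n) → consᴾ true k p *P consᴾ true l q ≋ []
consᴾ-true-*-consᴾ-true k l p q = mk≋ λ m → begin
  coeff (consᴾ true k p *P consᴾ true l q) m  ≡⟨ cong (λ r → coeff r m) (θ₁²≡0 p) ⟩
  coeff (0ℤ ·P pq) m                          ≡⟨ coeff-· 0ℤ pq m ⟩
  0ℤ * coeff pq m                             ≡⟨ ℤ.*-zeroˡ (coeff pq m) ⟩
  0ℤ                                          ∎
  where
  open ≡-Reasoning
  pq = consᴾ true (k ℕ.+ l) (p *P q)
  annihilate : ∀ c a → c * a * 0ℤ ≡ 0ℤ * (c * a)
  annihilate = solve-∀
  θ₁²≡0 : ∀ p → consᴾ true k p *P consᴾ true l q ≡ 0ℤ ·P consᴾ true (k ℕ.+ l) (p *P q)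
  θ₁²≡0 [] = refl
  θ₁²≡0 ((c , m) ∷ p) = begin
    (c , consᴹ true k m) ·ᵗ consᴾ true l q ++ consᴾ true k p *P consᴾ true l q
      ≡⟨ cong₂ _++_ (term q) (θ₁²≡0 p) ⟩
    0ℤ ·P consᴾ true (k ℕ.+ l) ((c , m) ·ᵗ q) ++ 0ℤ ·P consᴾ true (k ℕ.+ l) (p *P q)
      ≡⟨ ·-distrib-++ 0ℤ (consᴾ true (k ℕ.+ l) ((c , m) ·ᵗ q)) (consᴾ true (k ℕ.+ l) (p *P q)) ⟨
    0ℤ ·P (consᴾ true (k ℕ.+ l) ((c , m) ·ᵗ q) ++ consᴾ true (k ℕ.+ l) (p *P q))
      ≡⟨ cong (0ℤ ·P_) (consᴾ-++ true (k ℕ.+ l) ((c , m) ·ᵗ q) (p *P q)) ⟨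
    0ℤ ·P consᴾ true (k ℕ.+ l) ((c , m) ·ᵗ q ++ p *P q) ∎
    where
    term : ∀ q → (c , consᴹ true k m) ·ᵗ consᴾ true l q ≡ 0ℤ ·P consᴾ true (k ℕ.+ l) ((c , m) ·ᵗ q)
    term [] = refl
    term (u ∷ q) = cong₂ _∷_ (cong (_, _) (annihilate c (proj₁ u))) (term q)

ndots : DPerm → ℕ
ndots [] = 0
ndots (int _ ∷ w) = ndots w
ndots (dot _ ∷ w) = suc (ndots w)

_≺_ : DPerm → DPerm → Set
as ≺ bs = ∀ {a b} → a ∈ nonDotted as → b ∈ nonDotted bs → a < b

∈-nonDotted-drop : ∀ k w {y} → y ∈ nonDotted (drop k w) → y ∈ nonDotted w
∈-nonDotted-drop zero w y∈ = y∈
∈-nonDotted-drop (suc k) [] y∈ = y∈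
∈-nonDotted-drop (suc k) (int _ ∷ w) y∈ = there (∈-nonDotted-drop k w y∈)
∈-nonDotted-drop (suc k) (dot _ ∷ w) y∈ = ∈-nonDotted-drop k w y∈

IsDottedPermutation-drop : ∀ k w → IsDottedPermutation w → IsDottedPermutation (drop k w)
IsDottedPermutation-drop zero w u = u
IsDottedPermutation-drop (suc k) [] u = u
IsDottedPermutation-drop (suc k) (int _ ∷ w) u = IsDottedPermutation-drop k w (Unique.drop⁺ 1 u)
IsDottedPermutation-drop (suc k) (dot _ ∷ w) u = IsDottedPermutation-drop k w u

length-drop-≤ : ∀ k (w : DPerm) → length (drop k w) ≤ length w
length-drop-≤ k w = subst (_≤ length w) (sym (List.length-drop k w)) (ℕ.m∸n≤m (length w) k)

record Admissible (as bs : DPerm) (f : ℕ) : Set where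
  field
    fuel  : length as ℕ.+ length bs ≤ f
    permᶜ : IsDottedPermutation as
    permʳ : IsDottedPermutation bs
    below : as ≺ bs
open Admissible

tailᶜ : ∀ {x as bs f} → Admissible (x ∷ as) bs f → Admissible as bs (ℕ.pred f)
tailᶜ {x} {as} adm = record
  { fuel  = ℕ.suc[m]≤n⇒m≤pred[n] (fuel adm)
  ; permᶜ = IsDottedPermutation-drop 1 (x ∷ as) (permᶜ adm)
  ; permʳ = permʳ adm
  ; below = λ a∈ b∈ → below adm (∈-nonDotted-drop 1 (x ∷ as) a∈) b∈
  }

tailʳ : ∀ {x as bs f} → Admissible as (x ∷ bs) f → Admissible as bs (ℕ.pred f)
tailʳ {x} {as} {bs} {f} adm = record
  { fuel  = ℕ.suc[m]≤n⇒m≤pred[n] (subst (_≤ f) (ℕ.+-suc (length as) (length bs)) (fuel adm))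
  ; permᶜ = permᶜ adm
  ; permʳ = IsDottedPermutation-drop 1 (x ∷ bs) (permʳ adm)
  ; below = λ a∈ b∈ → below adm a∈ (∈-nonDotted-drop 1 (x ∷ bs) b∈)
  }

dropᶜ : ∀ k {as bs f} → Admissible as bs f → Admissible (drop k as) bs f
dropᶜ k {as} {bs} adm = record
  { fuel  = ℕ.≤-trans (ℕ.+-monoˡ-≤ (length bs) (length-drop-≤ k as)) (fuel adm)
  ; permᶜ = IsDottedPermutation-drop k as (permᶜ adm)
  ; permʳ = permʳ adm
  ; below = λ a∈ b∈ → below adm (∈-nonDotted-drop k as a∈) b∈
  }

dropʳ : ∀ k {as bs f} → Admissible as bs f → Admissible as (drop k bs) f
dropʳ k {as} {bs} adm = record
  { fuel  = ℕ.≤-trans (ℕ.+-monoʳ-≤ (length as) (length-drop-≤ k bs)) (fuel adm)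
  ; permᶜ = permᶜ adm
  ; permʳ = IsDottedPermutation-drop k bs (permʳ adm)
  ; below = λ a∈ b∈ → below adm a∈ (∈-nonDotted-drop k bs b∈)
  }

incRun-ascent : ∀ {a a′} w → a < a′ → incRun (int a ∷ int a′ ∷ w) ≡ suc (incRun (int a′ ∷ w))
incRun-ascent {a} {a′} w a<a′ =
  cong (λ b → if b then suc (incRun (int a′ ∷ w)) else 1) (dec-true (a <? a′) a<a′)

incRun-descent : ∀ {a a′} w → ¬ a < a′ → incRun (int a ∷ int a′ ∷ w) ≡ 1
incRun-descent {a} {a′} w a≮a′ =
  cong (λ b → if b then suc (incRun (int a′ ∷ w)) else 1) (dec-false (a <? a′) a≮a′)

≤-incRun-tail : ∀ {k a a′} w →
  suc (suc k) ≤ incRun (int a ∷ int a′ ∷ w) → suc k ≤ incRun (int a′ ∷ w)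
≤-incRun-tail {a = a} {a′} w k+2≤run with a <? a′ | k+2≤run
... | yes _ | s≤s k+1≤run = k+1≤run
... | no _  | s≤s ()

ndots-drop-incRun : ∀ k w → k ≤ incRun w → ndots (drop k w) ≡ ndots w
ndots-drop-incRun zero w _ = refl
ndots-drop-incRun (suc k) (int a ∷ []) (s≤s z≤n) = refl
ndots-drop-incRun (suc zero) (int a ∷ dot _ ∷ w) _ = refl
ndots-drop-incRun (suc zero) (int a ∷ int _ ∷ w) _ = refl
ndots-drop-incRun (suc (suc k)) (int a ∷ int a′ ∷ w) k+2≤run =
  ndots-drop-incRun (suc k) (int a′ ∷ w) (≤-incRun-tail {a = a} w k+2≤run)
ndots-drop-incRun (suc (suc k)) (int a ∷ dot _ ∷ w) (s≤s ())

oneTo-≤ : ∀ m → All (_≤ m) (oneTo m)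
oneTo-≤ m = All.map⁺ (All.applyUpTo⁺₁ (λ i → i) m (λ i<m → i<m))

ndots-drop-∈ : ∀ {k} w → k ∈ oneTo (incRun w) → ndots (drop k w) ≡ ndots w
ndots-drop-∈ {k} w k∈ = ndots-drop-incRun k w (All.lookup (oneTo-≤ (incRun w)) k∈)

isDescent : Maybe ℤ → ℤ → Bool
isDescent nothing x = false
isDescent (just p) x = does (x <? p)

_≺ᵐ_ : Maybe ℤ → DPerm → Set
nothing ≺ᵐ bs = ⊤
just p ≺ᵐ bs = ∀ {b} → b ∈ nonDotted bs → p < b

_≺ᵉ_ : DPerm → ℤ → Set
as ≺ᵉ p = ∀ {a} → a ∈ nonDotted as → a < p

no-descent : ∀ prev {b bs} → prev ≺ᵐ (int b ∷ bs) → isDescent prev b ≡ false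
no-descent nothing _ = refl
no-descent (just p) {b} p≺ = dec-false (b <? p) (λ b<p → ℤ.<-asym b<p (p≺ (here refl)))

-- runSum F k prev w = ∑ F (k + j) (drop j w), over the j such that the first j entries of w
-- are non-dotted and ascend after prev.
mutual
  runSum : (ℕ → DPerm → Poly n) → ℕ → Maybe ℤ → DPerm → Poly n
  runSum F k prev w = F k w ++ runSumTail F k prev w

  runSumTail : (ℕ → DPerm → Poly n) → ℕ → Maybe ℤ → DPerm → Poly n
  runSumTail F k prev (int x ∷ w) = if isDescent prev x then [] else runSum F (suc k) (just x) w
  runSumTail F k prev (dot _ ∷ w) = []
  runSumTail F k prev [] = []

mutual
  runSum-*ʳ : ∀ (F : ℕ → DPerm → Poly n) Q k prev w →
    runSum F k prev w *P Q ≡ runSum (λ j v → F j v *P Q) k prev w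
  runSum-*ʳ F Q k prev w = trans (*-distribʳ-++ (F k w) _ Q) (cong (F k w *P Q ++_) (runSumTail-*ʳ F Q k prev w))

  runSumTail-*ʳ : ∀ (F : ℕ → DPerm → Poly n) Q k prev w →
    runSumTail F k prev w *P Q ≡ runSumTail (λ j v → F j v *P Q) k prev w
  runSumTail-*ʳ F Q k prev (int x ∷ w) with isDescent prev x
  ... | true  = refl
  ... | false = runSum-*ʳ F Q (suc k) (just x) w
  runSumTail-*ʳ F Q k prev (dot _ ∷ w) = refl
  runSumTail-*ʳ F Q k prev [] = refl

mutual
  *-runSum : ∀ (Q : Poly n) F k prev w → Q *P runSum F k prev w ≋ runSum (λ j v → Q *P F j v) k prev w
  *-runSum Q F k prev w =
    ≋-trans (*-distribˡ-++ Q (F k w) _) (++-cong (≋-refl {p = Q *P F k w}) (*-runSumTail Q F k prev w))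

  *-runSumTail : ∀ (Q : Poly n) F k prev w → Q *P runSumTail F k prev w ≋ runSumTail (λ j v → Q *P F j v) k prev w
  *-runSumTail Q F k prev (int x ∷ w) with isDescent prev x
  ... | true  = ≡⇒≋ (*-zeroʳ Q)
  ... | false = *-runSum Q F (suc k) (just x) w
  *-runSumTail Q F k prev (dot _ ∷ w) = ≡⇒≋ (*-zeroʳ Q)
  *-runSumTail Q F k prev [] = ≡⇒≋ (*-zeroʳ Q)

mutual
  runSum-cong : ∀ {F G : ℕ → DPerm → Poly n} → (∀ j v → F j v ≋ G j v) →
    ∀ k prev w → runSum F k prev w ≋ runSum G k prev w
  runSum-cong F≋G k prev w = ++-cong (F≋G k w) (runSumTail-cong F≋G k prev w)

  runSumTail-cong : ∀ {F G : ℕ → DPerm → Poly n} → (∀ j v → F j v ≋ G j v) → ∀ k prev w →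
    runSumTail F k prev w ≋ runSumTail G k prev w
  runSumTail-cong F≋G k prev (int x ∷ w) with isDescent prev x
  ... | true  = ≋-refl
  ... | false = runSum-cong F≋G (suc k) (just x) w
  runSumTail-cong F≋G k prev (dot _ ∷ w) = ≋-refl
  runSumTail-cong F≋G k prev [] = ≋-refl

mutual
  runSum-shift : ∀ (F : ℕ → DPerm → Poly n) i j prev w →
    runSum F (i ℕ.+ j) prev w ≡ runSum (λ j′ → F (i ℕ.+ j′)) j prev w
  runSum-shift F i j prev w = cong (F (i ℕ.+ j) w ++_) (runSumTail-shift F i j prev w)

  runSumTail-shift : ∀ (F : ℕ → DPerm → Poly n) i j prev w →
    runSumTail F (i ℕ.+ j) prev w ≡ runSumTail (λ j′ → F (i ℕ.+ j′)) j prev w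
  runSumTail-shift F i j prev (int x ∷ w) with isDescent prev x
  ... | true  = refl
  ... | false = trans (cong (λ k → runSum F k (just x) w) (sym (ℕ.+-suc i j))) (runSum-shift F i (suc j) (just x) w)
  runSumTail-shift F i j prev (dot _ ∷ w) = refl
  runSumTail-shift F i j prev [] = refl

mutual
  runSum-θdegree : ∀ {F : ℕ → DPerm → Poly n} → (∀ j v → HasθDegree (ndots v) (F j v)) →
    ∀ k prev w → HasθDegree (ndots w) (runSum F k prev w)
  runSum-θdegree deg k prev w = All.++⁺ (deg k w) (runSumTail-θdegree deg k prev w)

  runSumTail-θdegree : ∀ {F : ℕ → DPerm → Poly n} → (∀ j v → HasθDegree (ndots v) (F j v)) →
    ∀ k prev w → HasθDegree (ndots w) (runSumTail F k prev w)
  runSumTail-θdegree deg k prev (int x ∷ w) with isDescent prev x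
  ... | true  = []
  ... | false = runSum-θdegree deg (suc k) (just x) w
  runSumTail-θdegree deg k prev (dot _ ∷ w) = []
  runSumTail-θdegree deg k prev [] = []

runLengths : DPerm → List ℕ
runLengths w = 0 ∷ oneTo (incRun w)

oneTo-suc : ∀ m → oneTo (suc m) ≡ 1 ∷ map suc (oneTo m)
oneTo-suc m = cong (1 ∷_) (cong (map suc) (sym (List.map-applyUpTo (λ i → i) suc m)))

-- runSum stops at a descent, as comp does, while incRun stops at a non-ascent: the two agree because
-- the entries are distinct.
runSum-after : ∀ (F : ℕ → DPerm → Poly n) j a w → IsDottedPermutation (int a ∷ w) →
  runSum F (suc j) (just a) w ≋ ∑[ k ∈ oneTo (incRun (int a ∷ w)) ] F (j ℕ.+ k) (drop k (int a ∷ w))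
runSum-after F j a [] _ = ≡⇒≋ (cong (λ k → F k [] ++ []) (ℕ.+-comm 1 j))
runSum-after F j a (dot x ∷ w) _ = ≡⇒≋ (cong (λ k → F k (dot x ∷ w) ++ []) (ℕ.+-comm 1 j))
runSum-after F j a (int a′ ∷ w) perm with ℤ.<-cmp a a′
... | tri< a<a′ _ a′≮a = begin
  F (suc j) (int a′ ∷ w) ++ runSumTail F (suc j) (just a) (int a′ ∷ w)
    ≡⟨ cong₂ _++_ (cong (λ k → F k (int a′ ∷ w)) (ℕ.+-comm 1 j))
                  (cong (λ b → if b then [] else runSum F (suc (suc j)) (just a′) w) (dec-false (a′ <? a) a′≮a)) ⟩
  F (j ℕ.+ 1) (int a′ ∷ w) ++ runSum F (suc (suc j)) (just a′) w
    ≈⟨ ++-cong ≋-refl (runSum-after F (suc j) a′ w (Unique.drop⁺ 1 perm)) ⟩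
  F (j ℕ.+ 1) (int a′ ∷ w) ++ ∑[ k ∈ ks ] F (suc j ℕ.+ k) (drop k (int a′ ∷ w))
    ≡⟨ cong (F (j ℕ.+ 1) (int a′ ∷ w) ++_)
            (∑-≡ ks λ k → cong (λ i → F i (drop k (int a′ ∷ w))) (sym (ℕ.+-suc j k))) ⟩
  F (j ℕ.+ 1) (int a′ ∷ w) ++ ∑[ k ∈ ks ] F (j ℕ.+ suc k) (drop (suc k) (int a ∷ int a′ ∷ w))
    ≡⟨ cong (F (j ℕ.+ 1) (int a′ ∷ w) ++_) (∑-map suc ks _) ⟨
  ∑[ k ∈ 1 ∷ map suc ks ] F (j ℕ.+ k) (drop k (int a ∷ int a′ ∷ w))
    ≡⟨ cong (λ ks → ∑[ k ∈ ks ] F (j ℕ.+ k) (drop k (int a ∷ int a′ ∷ w)))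
            (trans (sym (oneTo-suc (incRun (int a′ ∷ w)))) (cong oneTo (sym (incRun-ascent w a<a′)))) ⟩
  ∑[ k ∈ oneTo (incRun (int a ∷ int a′ ∷ w)) ] F (j ℕ.+ k) (drop k (int a ∷ int a′ ∷ w)) ∎
  where
  open ≋-Reasoning
  ks = oneTo (incRun (int a′ ∷ w))
... | tri≈ _ a≡a′ _ = ⊥-elim (All.head (AllPairs.head perm) a≡a′)
... | tri> a≮a′ _ a′<a = ≡⇒≋ (begin
  F (suc j) (int a′ ∷ w) ++ runSumTail F (suc j) (just a) (int a′ ∷ w)
    ≡⟨ cong₂ _++_ (cong (λ k → F k (int a′ ∷ w)) (ℕ.+-comm 1 j))
                  (cong (λ b → if b then [] else runSum F (suc (suc j)) (just a′) w) (dec-true (a′ <? a) a′<a)) ⟩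
  F (j ℕ.+ 1) (int a′ ∷ w) ++ []
    ≡⟨ cong (λ r → ∑[ k ∈ oneTo r ] F (j ℕ.+ k) (drop k (int a ∷ int a′ ∷ w))) (incRun-descent w a≮a′) ⟨
  ∑[ k ∈ oneTo (incRun (int a ∷ int a′ ∷ w)) ] F (j ℕ.+ k) (drop k (int a ∷ int a′ ∷ w)) ∎)
  where open ≡-Reasoning

runSum-expand : ∀ (F : ℕ → DPerm → Poly n) w → IsDottedPermutation w →
  runSum F 0 nothing w ≋ ∑[ k ∈ runLengths w ] F k (drop k w)
runSum-expand F [] _ = ≋-refl
runSum-expand F (dot _ ∷ w) _ = ≋-refl
runSum-expand F (int a ∷ w) perm = ++-cong (≋-refl {p = F 0 (int a ∷ w)}) (runSum-after F 0 a w perm)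

-- L_α expanded in its first variable

data NonEmpty {A : Set} : List A → Set where
  cons : ∀ x xs → NonEmpty (x ∷ xs)

compositions-nonEmpty : ∀ k → All NonEmpty (compositions k)
compositions-nonEmpty zero = []
compositions-nonEmpty (suc zero) = cons 1 [] ∷ []
compositions-nonEmpty (suc (suc k)) = All.concat⁺ (All.map⁺ (both (compositions-nonEmpty (suc k))))
  where
  both : ∀ {cs} → All NonEmpty cs → All (λ c → All NonEmpty ((1 ∷ c) ∷ bump c ∷ [])) cs
  both [] = []
  both (cons c₁ c′ ∷ ne) = (cons 1 _ ∷ cons (suc c₁) c′ ∷ []) ∷ both ne

L-nd : ∀ n K α → L n (nd K ∷ α) ≡ ∑[ c ∈ compositions K ] ∑[ r ∈ refinements α ] M n (map nd c ++ r)
L-nd n K α = trans (∑-concatMap (λ c → map (λ r → map nd c ++ r) (refinements α)) (compositions K) (M n))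
                   (∑-≡ (compositions K) λ c → ∑-map (λ r → map nd c ++ r) (refinements α) (M n))

L-zero-dt : ∀ a α → L 0 (dt a ∷ α) ≡ []
L-zero-dt a α = trans (∑-map (dt a ∷_) (refinements α) (M 0)) (∑-zero (refinements α))

L-zero-nd : ∀ k α → L 0 (nd (suc k) ∷ α) ≋ []
L-zero-nd k α = begin
  L 0 (nd (suc k) ∷ α)                                    ≡⟨ L-nd 0 (suc k) α ⟩
  ∑[ c ∈ cs ] ∑[ r ∈ refinements α ] M 0 (map nd c ++ r)  ≈⟨ ∑-cong-∈ cs vanish ⟩
  ∑[ c ∈ cs ] []                                          ≡⟨ ∑-zero cs ⟩
  []                                                      ∎
  where
  open ≋-Reasoning
  cs = compositions (suc k)
  vanish : ∀ {c} → c ∈ cs → ∑[ r ∈ refinements α ] M 0 (map nd c ++ r) ≋ []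
  vanish c∈ with All.lookup (compositions-nonEmpty (suc k)) c∈
  ... | cons c₁ c′ = ≡⇒≋ (∑-zero (refinements α))

L-suc-[] : ∀ n → L (suc n) [] ≡ consᴾ false 0 (L n [])
L-suc-[] n = sym (consᴾ-++ false 0 (M n []) [])

L-suc-dt : ∀ n a α → L (suc n) (dt a ∷ α) ≋ consᴾ false 0 (L n (dt a ∷ α)) ++ consᴾ true a (L n α)
L-suc-dt n a α = begin
  L (suc n) (dt a ∷ α)
    ≡⟨ ∑-map (dt a ∷_) rs (M (suc n)) ⟩
  ∑[ r ∈ rs ] (consᴾ true a (M n r) ++ consᴾ false 0 (M n (dt a ∷ r)))
    ≈⟨ ∑-++-distrib rs (λ r → consᴾ true a (M n r)) (λ r → consᴾ false 0 (M n (dt a ∷ r))) ⟩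
  ∑[ r ∈ rs ] consᴾ true a (M n r) ++ ∑[ r ∈ rs ] consᴾ false 0 (M n (dt a ∷ r))
    ≈⟨ ++-comm (∑[ r ∈ rs ] consᴾ true a (M n r)) _ ⟩
  ∑[ r ∈ rs ] consᴾ false 0 (M n (dt a ∷ r)) ++ ∑[ r ∈ rs ] consᴾ true a (M n r)
    ≡⟨ cong₂ _++_ (trans (cong (consᴾ false 0) (∑-map (dt a ∷_) rs (M n)))
                         (consᴾ-∑ false 0 rs (λ r → M n (dt a ∷ r))))
                  (consᴾ-∑ true a rs (M n)) ⟨
  consᴾ false 0 (L n (dt a ∷ α)) ++ consᴾ true a (L n α) ∎
  where
  open ≋-Reasoning
  rs = refinements α

-- x₁-leading n j (nd K ∷ α) = ∑_{1 ≤ i ≤ K} x₁^(j+i) L_{(K-i) ∷ α}(x₂, …), a part 0 being dropped;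
-- for j = 0 these are the terms of L_{(K) ∷ α}(x₁, …) that involve x₁.
x₁-leading : (n j : ℕ) → DComp → Poly (suc n)
x₁-leading n j (nd (suc zero) ∷ α) = consᴾ false (j ℕ.+ 1) (L n α)
x₁-leading n j (nd (suc (suc k)) ∷ α) =
  consᴾ false (j ℕ.+ 1) (L n (nd (suc k) ∷ α)) ++ x₁-leading n (suc j) (nd (suc k) ∷ α)
x₁-leading n j _ = []

-- the terms of ∑_r M_{c ++ r}(x₁, …) in which x₁ carries the first part of c, shifted by j
x₁-firstPart : (n : ℕ) → DComp → ℕ → List ℕ → Poly (suc n)
x₁-firstPart n α j [] = []
x₁-firstPart n α j (c₁ ∷ c) = consᴾ false (j ℕ.+ c₁) (∑[ r ∈ refinements α ] M n (map nd c ++ r))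

∑-x₁-firstPart : ∀ n α j k →
  ∑[ c ∈ compositions (suc k) ] x₁-firstPart n α j c ≋ x₁-leading n j (nd (suc k) ∷ α)
∑-x₁-firstPart n α j zero = ++-identityʳ _
∑-x₁-firstPart n α j (suc k) = begin
  ∑[ c ∈ concatMap (λ c → (1 ∷ c) ∷ bump c ∷ []) cs ] x₁-firstPart n α j c
    ≡⟨ ∑-concatMap (λ c → (1 ∷ c) ∷ bump c ∷ []) cs (x₁-firstPart n α j) ⟩
  ∑[ c ∈ cs ] (x₁-firstPart n α j (1 ∷ c) ++ (x₁-firstPart n α j (bump c) ++ []))
    ≈⟨ ∑-cong-∈ cs (λ c∈ →
         ++-cong ≋-refl (≋-trans (++-identityʳ _) (bump-shifts (All.lookup cs-nonEmpty c∈)))) ⟩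
  ∑[ c ∈ cs ] (x₁-firstPart n α j (1 ∷ c) ++ x₁-firstPart n α (suc j) c)
    ≈⟨ ∑-++-distrib cs (λ c → x₁-firstPart n α j (1 ∷ c)) (x₁-firstPart n α (suc j)) ⟩
  ∑[ c ∈ cs ] x₁-firstPart n α j (1 ∷ c) ++ ∑[ c ∈ cs ] x₁-firstPart n α (suc j) c
    ≈⟨ ++-cong (≡⇒≋ (trans (sym (consᴾ-∑ false (j ℕ.+ 1) cs _))
                           (cong (consᴾ false (j ℕ.+ 1)) (sym (L-nd n (suc k) α)))))
               (∑-x₁-firstPart n α (suc j) k) ⟩
  x₁-leading n j (nd (suc (suc k)) ∷ α) ∎
  where
  open ≋-Reasoning
  cs = compositions (suc k)
  cs-nonEmpty = compositions-nonEmpty (suc k)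
  bump-shifts : ∀ {c} → NonEmpty c → x₁-firstPart n α j (bump c) ≋ x₁-firstPart n α (suc j) c
  bump-shifts (cons c₁ c) =
    ≡⇒≋ (cong (λ i → consᴾ false i (∑[ r ∈ refinements α ] M n (map nd c ++ r))) (ℕ.+-suc j c₁))

L-suc-nd : ∀ n k α →
  L (suc n) (nd (suc k) ∷ α) ≋ consᴾ false 0 (L n (nd (suc k) ∷ α)) ++ x₁-leading n 0 (nd (suc k) ∷ α)
L-suc-nd n k α = begin
  L (suc n) (nd (suc k) ∷ α)
    ≡⟨ L-nd (suc n) (suc k) α ⟩
  ∑[ c ∈ cs ] ∑[ r ∈ rs ] M (suc n) (map nd c ++ r)
    ≈⟨ ∑-cong-∈ cs (λ c∈ → split (All.lookup (compositions-nonEmpty (suc k)) c∈)) ⟩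
  ∑[ c ∈ cs ] (consᴾ false 0 (∑[ r ∈ rs ] M n (map nd c ++ r)) ++ x₁-firstPart n α 0 c)
    ≈⟨ ∑-++-distrib cs (λ c → consᴾ false 0 (∑[ r ∈ rs ] M n (map nd c ++ r))) (x₁-firstPart n α 0) ⟩
  ∑[ c ∈ cs ] consᴾ false 0 (∑[ r ∈ rs ] M n (map nd c ++ r)) ++ ∑[ c ∈ cs ] x₁-firstPart n α 0 c
    ≈⟨ ++-cong (≡⇒≋ (trans (sym (consᴾ-∑ false 0 cs _)) (cong (consᴾ false 0) (sym (L-nd n (suc k) α)))))
               (∑-x₁-firstPart n α 0 k) ⟩
  consᴾ false 0 (L n (nd (suc k) ∷ α)) ++ x₁-leading n 0 (nd (suc k) ∷ α) ∎
  where
  open ≋-Reasoning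
  cs = compositions (suc k)
  rs = refinements α
  split : ∀ {c} → NonEmpty c →
    ∑[ r ∈ rs ] M (suc n) (map nd c ++ r)
      ≋ consᴾ false 0 (∑[ r ∈ rs ] M n (map nd c ++ r)) ++ x₁-firstPart n α 0 c
  split (cons c₁ c) = begin
    ∑[ r ∈ rs ] (consᴾ false c₁ (M n (γ r)) ++ consᴾ false 0 (M n (nd c₁ ∷ γ r)))
      ≈⟨ ∑-++-distrib rs (λ r → consᴾ false c₁ (M n (γ r))) (λ r → consᴾ false 0 (M n (nd c₁ ∷ γ r))) ⟩
    ∑[ r ∈ rs ] consᴾ false c₁ (M n (γ r)) ++ ∑[ r ∈ rs ] consᴾ false 0 (M n (nd c₁ ∷ γ r))
      ≈⟨ ++-comm (∑[ r ∈ rs ] consᴾ false c₁ (M n (γ r))) _ ⟩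
    ∑[ r ∈ rs ] consᴾ false 0 (M n (nd c₁ ∷ γ r)) ++ ∑[ r ∈ rs ] consᴾ false c₁ (M n (γ r))
      ≡⟨ cong₂ _++_ (consᴾ-∑ false 0 rs _) (consᴾ-∑ false c₁ rs _) ⟨
    consᴾ false 0 (∑[ r ∈ rs ] M n (nd c₁ ∷ γ r)) ++ x₁-firstPart n α 0 (c₁ ∷ c) ∎
    where
    γ : DComp → DComp
    γ r = map nd c ++ r

-- Expanding in x₁: either x₁ takes an ascending run of leading non-dotted entries of w
-- (these stay inside one part of comp w), or θ₁x₁ᵃ takes a leading dotted entry ȧ.
mutual
  Lᵂ : (n : ℕ) → DPerm → Poly n
  Lᵂ zero [] = (1ℤ , emptyMono) ∷ []
  Lᵂ zero (_ ∷ _) = []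
  Lᵂ (suc n) w = x₁-part n w ++ θ₁-part n w

  x₁^·Lᵂ : (n : ℕ) → ℕ → DPerm → Poly (suc n)
  x₁^·Lᵂ n k w = consᴾ false k (Lᵂ n w)

  x₁-part : (n : ℕ) → DPerm → Poly (suc n)
  x₁-part n = runSum (x₁^·Lᵂ n) 0 nothing

  θ₁-part : (n : ℕ) → DPerm → Poly (suc n)
  θ₁-part n (dot a ∷ w) = consᴾ true a (Lᵂ n w)
  θ₁-part n _ = []

Lᵂ-θdegree : ∀ n w → HasθDegree (ndots w) (Lᵂ n w)
Lᵂ-θdegree zero [] = refl ∷ []
Lᵂ-θdegree zero (_ ∷ _) = []
Lᵂ-θdegree (suc n) w =
  All.++⁺ (runSum-θdegree (λ j v → consᴾ-false-θdegree j (Lᵂ-θdegree n v)) 0 nothing w) (θ₁-part-θdegree w)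
  where
  θ₁-part-θdegree : ∀ w → HasθDegree (ndots w) (θ₁-part n w)
  θ₁-part-θdegree (dot a ∷ w) = consᴾ-true-θdegree a (Lᵂ-θdegree n w)
  θ₁-part-θdegree (int _ ∷ w) = []
  θ₁-part-θdegree [] = []

run-step : ∀ c e e′ r → run c (int e ∷ int e′ ∷ r)
  ≡ (if does (e′ <? e) then nd (suc c) ∷ run 0 (int e′ ∷ r) else run (suc c) (int e′ ∷ r))
run-step zero e e′ r = refl
run-step (suc c) e e′ r = refl

run-descent : ∀ {e e′ r} → e′ < e → ∀ c → run c (int e ∷ int e′ ∷ r) ≡ nd (suc c) ∷ run 0 (int e′ ∷ r)
run-descent {e} {e′} {r} e′<e c = trans (run-step c e e′ r)
  (cong (λ b → if b then nd (suc c) ∷ run 0 (int e′ ∷ r) else run (suc c) (int e′ ∷ r))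
        (dec-true (e′ <? e) e′<e))

run-ascent : ∀ {e e′ r} → ¬ e′ < e → ∀ c → run c (int e ∷ int e′ ∷ r) ≡ run (suc c) (int e′ ∷ r)
run-ascent {e} {e′} {r} e′≮e c = trans (run-step c e e′ r)
  (cong (λ b → if b then nd (suc c) ∷ run 0 (int e′ ∷ r) else run (suc c) (int e′ ∷ r))
        (dec-false (e′ <? e) e′≮e))

run-stops : ∀ {w β} → (∀ c → run c w ≡ nd (suc c) ∷ β) → ∀ c → run c w ≡ nd (suc (c ℕ.+ 0)) ∷ β
run-stops {β = β} shape c = trans (shape c) (cong (λ i → nd (suc i) ∷ β) (sym (ℕ.+-identityʳ c)))

run-first-part : ∀ e r → Σ ℕ λ k → Σ DComp λ β → ∀ c → run c (int e ∷ r) ≡ nd (suc (c ℕ.+ k)) ∷ β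
run-first-part e [] = 0 , [] , run-stops λ { zero → refl ; (suc c) → refl }
run-first-part e (dot a ∷ r) = 0 , dots (dot a ∷ r) , run-stops λ { zero → refl ; (suc c) → refl }
run-first-part e (int e′ ∷ r) with e′ <? e | run-first-part e′ r
... | yes e′<e | _ = 0 , run 0 (int e′ ∷ r) , run-stops (run-descent e′<e)
... | no e′≮e | k , β , shape = suc k , β , λ c →
  trans (run-ascent e′≮e c) (trans (shape (suc c)) (cong (λ i → nd (suc i) ∷ β) (sym (ℕ.+-suc c k))))

runSum-x₁-leading : ∀ n → (∀ w → L n (comp w) ≋ Lᵂ n w) →
  ∀ j e r → runSum (x₁^·Lᵂ n) (j ℕ.+ 1) (just e) r ≋ x₁-leading n j (run 0 (int e ∷ r))
runSum-x₁-leading n L≋Lᵂ j e [] =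
  ≋-trans (++-identityʳ _) (consᴾ-cong false (j ℕ.+ 1) (≋-sym (L≋Lᵂ [])))
runSum-x₁-leading n L≋Lᵂ j e (dot a ∷ r) =
  ≋-trans (++-identityʳ _) (consᴾ-cong false (j ℕ.+ 1) (≋-sym (L≋Lᵂ (dot a ∷ r))))
runSum-x₁-leading n L≋Lᵂ j e (int e′ ∷ r) with e′ <? e | run-first-part e′ r
... | yes _ | _ = ≋-trans (++-identityʳ _) (consᴾ-cong false (j ℕ.+ 1) (≋-sym (L≋Lᵂ (int e′ ∷ r))))
... | no _ | k , β , shape = begin
  consᴾ false (j ℕ.+ 1) (Lᵂ n (int e′ ∷ r)) ++ runSum (x₁^·Lᵂ n) (suc j ℕ.+ 1) (just e′) r
    ≈⟨ ++-cong (consᴾ-cong false (j ℕ.+ 1) (≋-sym (L≋Lᵂ (int e′ ∷ r))))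
               (runSum-x₁-leading n L≋Lᵂ (suc j) e′ r) ⟩
  consᴾ false (j ℕ.+ 1) (L n (run 0 (int e′ ∷ r))) ++ x₁-leading n (suc j) (run 0 (int e′ ∷ r))
    ≡⟨ cong (λ γ → consᴾ false (j ℕ.+ 1) (L n γ) ++ x₁-leading n (suc j) γ) (shape 0) ⟩
  x₁-leading n j (nd (suc (suc k)) ∷ β)
    ≡⟨ cong (x₁-leading n j) (shape 1) ⟨
  x₁-leading n j (run 1 (int e′ ∷ r)) ∎
  where open ≋-Reasoning

L-comp : ∀ n w → L n (comp w) ≋ Lᵂ n w
L-comp zero [] = ≋-refl
L-comp zero (dot a ∷ w) = ≡⇒≋ (L-zero-dt a (comp w))
L-comp zero (int e ∷ r) with run-first-part e r
... | k , β , shape = ≋-trans (≡⇒≋ (cong (L 0) (shape 0))) (L-zero-nd k β)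
L-comp (suc n) [] = begin
  L (suc n) []                ≡⟨ L-suc-[] n ⟩
  consᴾ false 0 (L n [])      ≈⟨ consᴾ-cong false 0 (L-comp n []) ⟩
  consᴾ false 0 (Lᵂ n [])     ≡⟨ trans (List.++-identityʳ _) (List.++-identityʳ _) ⟨
  Lᵂ (suc n) []               ∎
  where open ≋-Reasoning
L-comp (suc n) (dot a ∷ w) = begin
  L (suc n) (dt a ∷ comp w)
    ≈⟨ L-suc-dt n a (comp w) ⟩
  consᴾ false 0 (L n (dt a ∷ comp w)) ++ consᴾ true a (L n (comp w))
    ≈⟨ ++-cong (consᴾ-cong false 0 (L-comp n (dot a ∷ w))) (consᴾ-cong true a (L-comp n w)) ⟩
  consᴾ false 0 (Lᵂ n (dot a ∷ w)) ++ consᴾ true a (Lᵂ n w)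
    ≡⟨ cong (_++ consᴾ true a (Lᵂ n w)) (List.++-identityʳ _) ⟨
  Lᵂ (suc n) (dot a ∷ w) ∎
  where open ≋-Reasoning
L-comp (suc n) (int e ∷ r) with run-first-part e r
... | k , β , shape = begin
  L (suc n) (run 0 (int e ∷ r))
    ≡⟨ cong (L (suc n)) (shape 0) ⟩
  L (suc n) (nd (suc k) ∷ β)
    ≈⟨ L-suc-nd n k β ⟩
  consᴾ false 0 (L n (nd (suc k) ∷ β)) ++ x₁-leading n 0 (nd (suc k) ∷ β)
    ≡⟨ cong (λ γ → consᴾ false 0 (L n γ) ++ x₁-leading n 0 γ) (shape 0) ⟨
  consᴾ false 0 (L n (comp (int e ∷ r))) ++ x₁-leading n 0 (run 0 (int e ∷ r))
    ≈⟨ ++-cong (consᴾ-cong false 0 (L-comp n (int e ∷ r))) (≋-sym (runSum-x₁-leading n (L-comp n) 0 e r)) ⟩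
  x₁^·Lᵂ n 0 (int e ∷ r) ++ runSum (x₁^·Lᵂ n) 1 (just e) r
    ≡⟨ List.++-identityʳ _ ⟨
  Lᵂ (suc n) (int e ∷ r) ∎
  where open ≋-Reasoning

-- Sums over fundamental paths

-- e is the number of dotted rows already passed: each later step across a dotted column
-- (step (1) or (3)) passes over e dotted cells.
pathSumOver : (DPerm → Poly n) → ℕ → DPerm → DPerm → List (List Step) → Poly n
pathSumOver G e as bs Ps = ∑[ P ∈ Ps ] -1^ proj₂ (walk as bs e P) ·P G (proj₁ (walk as bs e P))

pathSum : (DPerm → Poly n) → ℕ → DPerm → DPerm → ℕ → Poly n
pathSum G e as bs f = pathSumOver G e as bs (pathsF f as bs)

pathSum-cong : ∀ {G H : DPerm → Poly n} → (∀ w → G w ≋ H w) →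
  ∀ e as bs f → pathSum G e as bs f ≋ pathSum H e as bs f
pathSum-cong G≋H e as bs f =
  ∑-cong (pathsF f as bs) λ P → ·-cong (-1^ proj₂ (walk as bs e P)) (G≋H (proj₁ (walk as bs e P)))

pathSum-++ : ∀ (G H : DPerm → Poly n) e as bs f →
  pathSum (λ w → G w ++ H w) e as bs f ≋ pathSum G e as bs f ++ pathSum H e as bs f
pathSum-++ G H e as bs f = begin
  ∑[ P ∈ Ps ] -1^ d P ·P (G (π P) ++ H (π P))
    ≡⟨ ∑-≡ Ps (λ P → ·-distrib-++ (-1^ d P) (G (π P)) (H (π P))) ⟩
  ∑[ P ∈ Ps ] (-1^ d P ·P G (π P) ++ -1^ d P ·P H (π P))
    ≈⟨ ∑-++-distrib Ps (λ P → -1^ d P ·P G (π P)) (λ P → -1^ d P ·P H (π P)) ⟩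
  pathSum G e as bs f ++ pathSum H e as bs f ∎
  where
  open ≋-Reasoning
  Ps = pathsF f as bs
  d = λ P → proj₂ (walk as bs e P)
  π = λ P → proj₁ (walk as bs e P)

pathSum-consᴾ : ∀ b k (G : DPerm → Poly n) e as bs f →
  pathSum (λ w → consᴾ b k (G w)) e as bs f ≡ consᴾ b k (pathSum G e as bs f)
pathSum-consᴾ b k G e as bs f = trans
  (∑-≡ (pathsF f as bs) λ P → sym (consᴾ-· b k (-1^ proj₂ (walk as bs e P)) (G (proj₁ (walk as bs e P)))))
  (sym (consᴾ-∑ b k (pathsF f as bs) _))

pathSum-vanishing : ∀ {G : DPerm → Poly n} → (∀ w → G w ≋ []) → ∀ e as bs f → pathSum G e as bs f ≋ []
pathSum-vanishing G≋[] e as bs f = ≋-trans (pathSum-cong G≋[] e as bs f) (≡⇒≋ (∑-zero (pathsF f as bs)))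

∑-sign-factor : ∀ c (d : I → ℕ) (F : I → Poly n) xs →
  ∑[ x ∈ xs ] -1^ (c ℕ.+ d x) ·P F x ≡ -1^ c ·P (∑[ x ∈ xs ] -1^ d x ·P F x)
∑-sign-factor c d F xs = trans
  (∑-≡ xs λ x → trans (cong (_·P F x) (-1^-+ c (d x))) (sym (·-assoc (-1^ c) (-1^ d x) (F x))))
  (∑-· (-1^ c) xs (λ x → -1^ d x ·P F x))

module _ (G : DPerm → Poly n) (e : ℕ) where

  right-paths : ∀ a as bs Ps →
    pathSumOver G e (a ∷ as) bs (map (right ∷_) Ps)
      ≡ -1^ (isDot a ℕ.* e) ·P pathSumOver (λ w → G (a ∷ w)) e as bs Ps
  right-paths a as bs Ps = trans (∑-map (right ∷_) Ps _)
    (∑-sign-factor (isDot a ℕ.* e) (λ P → proj₂ (walk as bs e P)) (λ P → G (a ∷ proj₁ (walk as bs e P))) Ps)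

  up-paths : ∀ as b bs Ps →
    pathSumOver G e as (b ∷ bs) (map (up ∷_) Ps) ≡ pathSumOver (λ w → G (b ∷ w)) (isDot b ℕ.+ e) as bs Ps
  up-paths [] b bs Ps = ∑-map (up ∷_) Ps _
  up-paths (a ∷ as) b bs Ps = ∑-map (up ∷_) Ps _

  diagR-paths : ∀ a as bs ks (Ps : ℕ → List (List Step)) →
    pathSumOver G e (dot a ∷ as) bs (concatMap (λ k → map (diagR k ∷_) (Ps k)) ks)
      ≡ ∑[ k ∈ ks ] -1^ e ·P pathSumOver (λ w → G (dot (a ℕ.+ k) ∷ w)) e as (drop k bs) (Ps k)
  diagR-paths a as bs ks Ps = trans (∑-concatMap (λ k → map (diagR k ∷_) (Ps k)) ks _)
    (∑-≡ ks λ k → trans (∑-map (diagR k ∷_) (Ps k) _)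
      (∑-sign-factor e (λ P → proj₂ (walk as (drop k bs) e P))
                       (λ P → G (dot (a ℕ.+ k) ∷ proj₁ (walk as (drop k bs) e P))) (Ps k)))

  diagU-paths : ∀ as b bs ks (Ps : ℕ → List (List Step)) →
    pathSumOver G e as (dot b ∷ bs) (concatMap (λ k → map (diagU k ∷_) (Ps k)) ks)
      ≡ ∑[ k ∈ ks ] pathSumOver (λ w → G (dot (b ℕ.+ k) ∷ w)) (suc e) (drop k as) bs (Ps k)
  diagU-paths as b bs ks Ps = trans (∑-concatMap (λ k → map (diagU k ∷_) (Ps k)) ks _) (∑-≡ ks (step as))
    where
    step : ∀ as k → pathSumOver G e as (dot b ∷ bs) (map (diagU k ∷_) (Ps k))
                    ≡ pathSumOver (λ w → G (dot (b ℕ.+ k) ∷ w)) (suc e) (drop k as) bs (Ps k)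
    step [] k = ∑-map (diagU k ∷_) (Ps k) _
    step (_ ∷ _) k = ∑-map (diagU k ∷_) (Ps k) _

  diagR-steps : ℕ → DPerm → DPerm → ℕ → Poly n
  diagR-steps a as bs f =
    ∑[ k ∈ oneTo (incRun bs) ] -1^ e ·P pathSum (λ w → G (dot (a ℕ.+ k) ∷ w)) e as (drop k bs) f

  diagU-steps : DPerm → ℕ → DPerm → ℕ → Poly n
  diagU-steps as b bs f =
    ∑[ k ∈ oneTo (incRun as) ] pathSum (λ w → G (dot (b ℕ.+ k) ∷ w)) (suc e) (drop k as) bs f

  -- The first entry of Π(P) comes from the first column (steps (1), (3)) or the first row (steps (2), (4)).
  columnFirst : DPerm → DPerm → ℕ → Poly n
  columnFirst [] bs f = []
  columnFirst (int a ∷ as) bs f = pathSum (λ w → G (int a ∷ w)) e as bs f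
  columnFirst (dot a ∷ as) bs f = -1^ e ·P pathSum (λ w → G (dot a ∷ w)) e as bs f ++ diagR-steps a as bs f

  rowFirst : DPerm → DPerm → ℕ → Poly n
  rowFirst as [] f = []
  rowFirst as (int b ∷ bs) f = pathSum (λ w → G (int b ∷ w)) e as bs f
  rowFirst as (dot b ∷ bs) f = pathSum (λ w → G (dot b ∷ w)) (suc e) as bs f ++ diagU-steps as b bs f

sign-*-identityˡ : ∀ e (X : Poly n) → -1^ (1 ℕ.* e) ·P X ≡ -1^ e ·P X
sign-*-identityˡ e X = cong (λ i → -1^ i ·P X) (ℕ.*-identityˡ e)

endpoint : (DPerm → Poly n) → DPerm → DPerm → Poly n
endpoint G [] [] = G []
endpoint G (_ ∷ _) bs = []
endpoint G [] (_ ∷ _) = []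

pathSum-suc : ∀ (G : DPerm → Poly n) e as bs f →
  pathSum G e as bs (suc f) ≋ endpoint G as bs ++ (columnFirst G e as bs f ++ rowFirst G e as bs f)
pathSum-suc G e [] [] f = ≡⇒≋ (cong (_++ []) (·-identityˡ (G [])))
pathSum-suc G e [] (int b ∷ bs) f = ≡⇒≋ (up-paths G e [] (int b) bs (pathsF f [] bs))
pathSum-suc G e [] (dot b ∷ bs) f =
  ≡⇒≋ (trans (up-paths G e [] (dot b) bs (pathsF f [] bs)) (sym (List.++-identityʳ _)))
pathSum-suc G e (int a ∷ as) [] f =
  ≡⇒≋ (trans (right-paths G e (int a) as [] (pathsF f as [])) (trans (·-identityˡ _) (sym (List.++-identityʳ _))))
pathSum-suc G e (dot a ∷ as) [] f =
  ≡⇒≋ (trans (right-paths G e (dot a) as [] (pathsF f as []))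
      (trans (sign-*-identityˡ e _) (sym (trans (List.++-identityʳ _) (List.++-identityʳ _)))))
pathSum-suc G e (int a ∷ as) (int b ∷ bs) f =
  ≡⇒≋ (trans (∑-++ (map (right ∷_) (pathsF f as (int b ∷ bs))) (map (up ∷_) (pathsF f (int a ∷ as) bs)) _)
      (cong₂ _++_ (trans (right-paths G e (int a) as (int b ∷ bs) (pathsF f as (int b ∷ bs))) (·-identityˡ _))
                  (up-paths G e (int a ∷ as) (int b) bs (pathsF f (int a ∷ as) bs))))
pathSum-suc G e (int a ∷ as) (dot b ∷ bs) f =
  ≡⇒≋ (trans (∑-++ right-ps (up-ps ++ diag-ps) _)
      (cong₂ _++_ (trans (right-paths G e (int a) as (dot b ∷ bs) (pathsF f as (dot b ∷ bs))) (·-identityˡ _))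
                  (trans (∑-++ up-ps diag-ps _)
                         (cong₂ _++_ (up-paths G e (int a ∷ as) (dot b) bs (pathsF f (int a ∷ as) bs))
                                     (diagU-paths G e (int a ∷ as) b bs ks diag-paths)))))
  where
  ks = oneTo (incRun (int a ∷ as))
  right-ps = map (right ∷_) (pathsF f as (dot b ∷ bs))
  up-ps = map (up ∷_) (pathsF f (int a ∷ as) bs)
  diag-paths = λ k → pathsF f (drop k (int a ∷ as)) bs
  diag-ps = concatMap (λ k → map (diagU k ∷_) (diag-paths k)) ks
pathSum-suc G e (dot a ∷ as) (int b ∷ bs) f = begin
  pathSumOver G e (dot a ∷ as) (int b ∷ bs) (right-ps ++ (up-ps ++ diag-ps))
    ≡⟨ ∑-++ right-ps (up-ps ++ diag-ps) _ ⟩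
  pathSumOver G e (dot a ∷ as) (int b ∷ bs) right-ps ++ pathSumOver G e (dot a ∷ as) (int b ∷ bs) (up-ps ++ diag-ps)
    ≡⟨ cong₂ _++_ (trans (right-paths G e (dot a) as (int b ∷ bs) (pathsF f as (int b ∷ bs)))
                         (sign-*-identityˡ e _))
                  (trans (∑-++ up-ps diag-ps _)
                         (cong₂ _++_ (up-paths G e (dot a ∷ as) (int b) bs (pathsF f (dot a ∷ as) bs))
                                     (diagR-paths G e a as (int b ∷ bs) ks diag-paths))) ⟩
  R ++ (U ++ D)
    ≈⟨ ++-cong (≋-refl {p = R}) (++-comm U D) ⟩
  R ++ (D ++ U)
    ≡⟨ List.++-assoc R D U ⟨
  (R ++ D) ++ U ∎
  where
  open ≋-Reasoning
  ks = oneTo (incRun (int b ∷ bs))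
  right-ps = map (right ∷_) (pathsF f as (int b ∷ bs))
  up-ps = map (up ∷_) (pathsF f (dot a ∷ as) bs)
  diag-paths = λ k → pathsF f as (drop k (int b ∷ bs))
  diag-ps = concatMap (λ k → map (diagR k ∷_) (diag-paths k)) ks
  R = -1^ e ·P pathSum (λ w → G (dot a ∷ w)) e as (int b ∷ bs) f
  U = rowFirst G e (dot a ∷ as) (int b ∷ bs) f
  D = diagR-steps G e a as (int b ∷ bs) f
pathSum-suc G e (dot a ∷ as) (dot b ∷ bs) f =
  ≡⇒≋ (trans (∑-++ (map (right ∷_) (pathsF f as (dot b ∷ bs))) (map (up ∷_) (pathsF f (dot a ∷ as) bs)) _)
      (cong₂ _++_ (trans (right-paths G e (dot a) as (dot b ∷ bs) (pathsF f as (dot b ∷ bs)))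
                         (trans (sign-*-identityˡ e _) (sym (List.++-identityʳ _))))
                  (trans (up-paths G e (dot a ∷ as) (dot b) bs (pathsF f (dot a ∷ as) bs))
                         (sym (List.++-identityʳ _)))))

pathSum-step : ∀ (G : DPerm → Poly n) e {as bs f} → Admissible as bs f →
  pathSum G e as bs f ≋ endpoint G as bs ++ (columnFirst G e as bs (ℕ.pred f) ++ rowFirst G e as bs (ℕ.pred f))
pathSum-step G e {as} {bs} {suc f} _ = pathSum-suc G e as bs f
pathSum-step G e {[]} {[]} {zero} _ = ≡⇒≋ (cong (_++ []) (·-identityˡ (G [])))
pathSum-step G e {_ ∷ _} {_} {zero} adm with fuel adm
... | ()
pathSum-step G e {[]} {_ ∷ _} {zero} adm with fuel adm
... | ()

endpoint-vanishing : ∀ {G : DPerm → Poly n} → G [] ≋ [] → ∀ as bs → endpoint G as bs ≋ []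
endpoint-vanishing G[]≋[] [] [] = G[]≋[]
endpoint-vanishing G[]≋[] (_ ∷ _) bs = ≋-refl
endpoint-vanishing G[]≋[] [] (_ ∷ _) = ≋-refl

module _ {G : DPerm → Poly n} (dotted≋[] : ∀ a w → G (dot a ∷ w) ≋ []) (e : ℕ) where

  columnFirst-dot-vanishing : ∀ a as bs f → columnFirst G e (dot a ∷ as) bs f ≋ []
  columnFirst-dot-vanishing a as bs f = ++-cong
    (·-cong (-1^ e) (pathSum-vanishing (dotted≋[] a) e as bs f))
    (∑-vanishing (oneTo (incRun bs)) λ k →
      ·-cong (-1^ e) (pathSum-vanishing (dotted≋[] (a ℕ.+ k)) e as (drop k bs) f))

  rowFirst-dot-vanishing : ∀ as b bs f → rowFirst G e as (dot b ∷ bs) f ≋ []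
  rowFirst-dot-vanishing as b bs f = ++-cong
    (pathSum-vanishing (dotted≋[] b) (suc e) as bs f)
    (∑-vanishing (oneTo (incRun as)) λ k → pathSum-vanishing (dotted≋[] (b ℕ.+ k)) (suc e) (drop k as) bs f)

pathSum-supported-[] : ∀ {G : DPerm → Poly n} → (∀ x w → G (x ∷ w) ≋ []) →
  ∀ e {as bs f} → Admissible as bs f → pathSum G e as bs f ≋ endpoint G as bs
pathSum-supported-[] {G = G} nonempty≋[] e {as} {bs} {f} adm = begin
  pathSum G e as bs f
    ≈⟨ pathSum-step G e adm ⟩
  endpoint G as bs ++ (columnFirst G e as bs (ℕ.pred f) ++ rowFirst G e as bs (ℕ.pred f))
    ≈⟨ ++-cong (≋-refl {p = endpoint G as bs}) (++-cong (column as) (row bs)) ⟩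
  endpoint G as bs ++ []
    ≈⟨ ++-identityʳ _ ⟩
  endpoint G as bs ∎
  where
  open ≋-Reasoning
  column : ∀ as → columnFirst G e as bs (ℕ.pred f) ≋ []
  column [] = ≋-refl
  column (int a ∷ as) = pathSum-vanishing (nonempty≋[] (int a)) e as bs (ℕ.pred f)
  column (dot a ∷ as) = columnFirst-dot-vanishing {G = G} (λ a → nonempty≋[] (dot a)) e a as bs (ℕ.pred f)
  row : ∀ bs → rowFirst G e as bs (ℕ.pred f) ≋ []
  row [] = ≋-refl
  row (int b ∷ bs) = pathSum-vanishing (nonempty≋[] (int b)) e as bs (ℕ.pred f)
  row (dot b ∷ bs) = rowFirst-dot-vanishing {G = G} (λ b → nonempty≋[] (dot b)) e as b bs (ℕ.pred f)

-- The path sum of Lᵂ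

ndots-drop-runLengths : ∀ {k} w → k ∈ runLengths w → ndots (drop k w) ≡ ndots w
ndots-drop-runLengths w (here refl) = refl
ndots-drop-runLengths w (there k∈) = ndots-drop-∈ w k∈

x₁-part-*-θ₁ : ∀ n {as} b (Q : Poly n) → IsDottedPermutation as →
  x₁-part n as *P consᴾ true b Q
    ≋ -1^ ndots as ·P (∑[ k ∈ runLengths as ] consᴾ true (k ℕ.+ b) (Lᵂ n (drop k as) *P Q))
x₁-part-*-θ₁ n {as} b Q perm = begin
  x₁-part n as *P consᴾ true b Q
    ≡⟨ runSum-*ʳ (x₁^·Lᵂ n) (consᴾ true b Q) 0 nothing as ⟩
  runSum (λ j v → consᴾ false j (Lᵂ n v) *P consᴾ true b Q) 0 nothing as
    ≈⟨ runSum-cong (λ j v → ≡⇒≋ (consᴾ-false-*-consᴾ-true j b Q (Lᵂ-θdegree n v))) 0 nothing as ⟩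
  runSum (λ j v → -1^ ndots v ·P consᴾ true (j ℕ.+ b) (Lᵂ n v *P Q)) 0 nothing as
    ≈⟨ runSum-expand (λ j v → -1^ ndots v ·P consᴾ true (j ℕ.+ b) (Lᵂ n v *P Q)) as perm ⟩
  ∑[ k ∈ runLengths as ] -1^ ndots (drop k as) ·P consᴾ true (k ℕ.+ b) (Lᵂ n (drop k as) *P Q)
    ≈⟨ ∑-cong-∈ (runLengths as) (λ {k} k∈ →
         ≡⇒≋ (cong (λ d → -1^ d ·P consᴾ true (k ℕ.+ b) (Lᵂ n (drop k as) *P Q))
                   (ndots-drop-runLengths as k∈))) ⟩
  ∑[ k ∈ runLengths as ] -1^ ndots as ·P consᴾ true (k ℕ.+ b) (Lᵂ n (drop k as) *P Q)
    ≡⟨ ∑-· (-1^ ndots as) (runLengths as) (λ k → consᴾ true (k ℕ.+ b) (Lᵂ n (drop k as) *P Q)) ⟩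
  -1^ ndots as ·P (∑[ k ∈ runLengths as ] consᴾ true (k ℕ.+ b) (Lᵂ n (drop k as) *P Q)) ∎
  where open ≋-Reasoning

θ₁-*-x₁-part : ∀ n a (P : Poly n) {bs} → IsDottedPermutation bs →
  consᴾ true a P *P x₁-part n bs ≋ ∑[ k ∈ runLengths bs ] consᴾ true (a ℕ.+ k) (P *P Lᵂ n (drop k bs))
θ₁-*-x₁-part n a P {bs} perm = begin
  consᴾ true a P *P x₁-part n bs
    ≈⟨ *-runSum (consᴾ true a P) (x₁^·Lᵂ n) 0 nothing bs ⟩
  runSum (λ j v → consᴾ true a P *P consᴾ false j (Lᵂ n v)) 0 nothing bs
    ≈⟨ runSum-cong (λ j v → ≡⇒≋ (consᴾ-*-consᴾ-false true a j P (Lᵂ n v))) 0 nothing bs ⟩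
  runSum (λ j v → consᴾ true (a ℕ.+ j) (P *P Lᵂ n v)) 0 nothing bs
    ≈⟨ runSum-expand (λ j v → consᴾ true (a ℕ.+ j) (P *P Lᵂ n v)) bs perm ⟩
  ∑[ k ∈ runLengths bs ] consᴾ true (a ℕ.+ k) (P *P Lᵂ n (drop k bs)) ∎
  where open ≋-Reasoning

x₁^-*-runSum : ∀ n k (P : Poly n) j prev w →
  consᴾ false k P *P runSum (x₁^·Lᵂ n) j prev w ≋ consᴾ false 0 P *P runSum (x₁^·Lᵂ n) (k ℕ.+ j) prev w
x₁^-*-runSum n k P j prev w = begin
  consᴾ false k P *P runSum (x₁^·Lᵂ n) j prev w
    ≈⟨ *-runSum (consᴾ false k P) (x₁^·Lᵂ n) j prev w ⟩
  runSum (λ j′ v → consᴾ false k P *P consᴾ false j′ (Lᵂ n v)) j prev w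
    ≈⟨ runSum-cong (λ j′ v → ≡⇒≋ (consᴾ-*-consᴾ-false false k j′ P (Lᵂ n v))) j prev w ⟩
  runSum (λ j′ v → consᴾ false (k ℕ.+ j′) (P *P Lᵂ n v)) j prev w
    ≡⟨ runSum-shift (λ i v → consᴾ false i (P *P Lᵂ n v)) k j prev w ⟨
  runSum (λ i v → consᴾ false i (P *P Lᵂ n v)) (k ℕ.+ j) prev w
    ≈⟨ runSum-cong (λ i v → ≡⇒≋ (consᴾ-*-consᴾ-false false 0 i P (Lᵂ n v))) (k ℕ.+ j) prev w ⟨
  runSum (λ i v → consᴾ false 0 P *P consᴾ false i (Lᵂ n v)) (k ℕ.+ j) prev w
    ≈⟨ *-runSum (consᴾ false 0 P) (x₁^·Lᵂ n) (k ℕ.+ j) prev w ⟨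
  consᴾ false 0 P *P runSum (x₁^·Lᵂ n) (k ℕ.+ j) prev w ∎
  where open ≋-Reasoning

θ₁-part-*-θ₁-part : ∀ n as bs → θ₁-part n as *P θ₁-part n bs ≋ []
θ₁-part-*-θ₁-part n (dot a ∷ as) (dot b ∷ bs) = consᴾ-true-*-consᴾ-true a b (Lᵂ n as) (Lᵂ n bs)
θ₁-part-*-θ₁-part n (dot a ∷ as) (int _ ∷ bs) = ≡⇒≋ (*-zeroʳ (consᴾ true a (Lᵂ n as)))
θ₁-part-*-θ₁-part n (dot a ∷ as) [] = ≡⇒≋ (*-zeroʳ (consᴾ true a (Lᵂ n as)))
θ₁-part-*-θ₁-part n (int _ ∷ as) bs = ≋-refl
θ₁-part-*-θ₁-part n [] bs = ≋-refl

runSum-*-x₁-part : ∀ n k prev as bs →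
  runSum (x₁^·Lᵂ n) k prev as *P x₁-part n bs
    ≋ consᴾ false k (Lᵂ n as *P Lᵂ n bs)
      ++ (consᴾ false k (Lᵂ n as) *P runSumTail (x₁^·Lᵂ n) 0 nothing bs
          ++ runSumTail (x₁^·Lᵂ n) k prev as *P x₁-part n bs)
runSum-*-x₁-part n k prev as bs = begin
  (Xᵃ ++ T) *P (Xᵇ ++ T₀)
    ≡⟨ *-distribʳ-++ Xᵃ T (Xᵇ ++ T₀) ⟩
  Xᵃ *P (Xᵇ ++ T₀) ++ T *P (Xᵇ ++ T₀)
    ≈⟨ ++-cong (*-distribˡ-++ Xᵃ Xᵇ T₀) (≋-refl {p = T *P (Xᵇ ++ T₀)}) ⟩
  (Xᵃ *P Xᵇ ++ Xᵃ *P T₀) ++ T *P (Xᵇ ++ T₀)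
    ≡⟨ List.++-assoc (Xᵃ *P Xᵇ) (Xᵃ *P T₀) _ ⟩
  Xᵃ *P Xᵇ ++ (Xᵃ *P T₀ ++ T *P (Xᵇ ++ T₀))
    ≡⟨ cong (_++ (Xᵃ *P T₀ ++ T *P (Xᵇ ++ T₀))) (consᴾ-*-consᴾ-false false k 0 (Lᵂ n as) (Lᵂ n bs)) ⟩
  consᴾ false (k ℕ.+ 0) (Lᵂ n as *P Lᵂ n bs) ++ (Xᵃ *P T₀ ++ T *P (Xᵇ ++ T₀))
    ≡⟨ cong (λ i → consᴾ false i (Lᵂ n as *P Lᵂ n bs) ++ (Xᵃ *P T₀ ++ T *P (Xᵇ ++ T₀))) (ℕ.+-identityʳ k) ⟩
  consᴾ false k (Lᵂ n as *P Lᵂ n bs) ++ (Xᵃ *P T₀ ++ T *P (Xᵇ ++ T₀)) ∎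
  where
  open ≋-Reasoning
  Xᵃ = x₁^·Lᵂ n k as
  Xᵇ = x₁^·Lᵂ n 0 bs
  T = runSumTail (x₁^·Lᵂ n) k prev as
  T₀ = runSumTail (x₁^·Lᵂ n) 0 nothing bs

x₁⁰-*-runSum : ∀ n k prev as bs →
  consᴾ false 0 (Lᵂ n as) *P runSum (x₁^·Lᵂ n) k prev bs
    ≋ consᴾ false k (Lᵂ n as *P Lᵂ n bs) ++ consᴾ false 0 (Lᵂ n as) *P runSumTail (x₁^·Lᵂ n) k prev bs
x₁⁰-*-runSum n k prev as bs =
  ≋-trans (*-distribˡ-++ (consᴾ false 0 (Lᵂ n as)) (x₁^·Lᵂ n k bs) _)
          (++-cong (≡⇒≋ (consᴾ-*-consᴾ-false false 0 k (Lᵂ n as) (Lᵂ n bs))) ≋-refl)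

sgn : ℕ → DPerm → ℤ
sgn e as = -1^ (e ℕ.* ndots as)

PathSumFormula : ℕ → Set
PathSumFormula n = ∀ e {as bs f} → Admissible as bs f →
  pathSum (Lᵂ n) e as bs f ≋ sgn e as ·P (Lᵂ n as *P Lᵂ n bs)

pathSum-Lᵂ-zero : PathSumFormula 0
pathSum-Lᵂ-zero e {as} {bs} adm = ≋-trans (pathSum-supported-[] (λ _ _ → ≋-refl) e adm) (endpoints as bs)
  where
  endpoints : ∀ as bs → endpoint (Lᵂ 0) as bs ≋ sgn e as ·P (Lᵂ 0 as *P Lᵂ 0 bs)
  endpoints [] [] = ≡⇒≋ (sym (trans (cong (λ d → -1^ d ·P Lᵂ 0 []) (ℕ.*-zeroʳ e)) (·-identityˡ _)))
  endpoints (_ ∷ _) bs = ≋-refl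
  endpoints [] (_ ∷ _) = ≋-refl

sgn-dotted-row : ∀ e as → sgn e as * -1^ ndots as ≡ sgn (suc e) as
sgn-dotted-row e as = trans (ℤ.*-comm (sgn e as) (-1^ ndots as)) (sym (-1^-+ (ndots as) (e ℕ.* ndots as)))

sgn-dotted-column : ∀ e a as → -1^ e * sgn e as ≡ sgn e (dot a ∷ as)
sgn-dotted-column e a as = trans (sym (-1^-+ e (e ℕ.* ndots as))) (cong -1^_ (sym (ℕ.*-suc e (ndots as))))

module InductionStep (n : ℕ) (IH : PathSumFormula n) where

  F : ℕ → DPerm → Poly (suc n)
  F = x₁^·Lᵂ n

  pathSum-consᴾ-Lᵂ : ∀ b k e {as bs f} → Admissible as bs f →
    pathSum (λ w → consᴾ b k (Lᵂ n w)) e as bs f ≋ sgn e as ·P consᴾ b k (Lᵂ n as *P Lᵂ n bs)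
  pathSum-consᴾ-Lᵂ b k e {as} {bs} {f} adm = begin
    pathSum (λ w → consᴾ b k (Lᵂ n w)) e as bs f    ≡⟨ pathSum-consᴾ b k (Lᵂ n) e as bs f ⟩
    consᴾ b k (pathSum (Lᵂ n) e as bs f)            ≈⟨ consᴾ-cong b k (IH e adm) ⟩
    consᴾ b k (sgn e as ·P (Lᵂ n as *P Lᵂ n bs))    ≡⟨ consᴾ-· b k (sgn e as) (Lᵂ n as *P Lᵂ n bs) ⟩
    sgn e as ·P consᴾ b k (Lᵂ n as *P Lᵂ n bs)      ∎
    where open ≋-Reasoning

  -- Once the run of x₁ has reached a row entry p, no column entry (all of them below p) can join it.
  mutual
    pathSum-runSum-rows : ∀ k p e {as bs f} → Admissible as bs f → as ≺ᵉ p →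
      pathSum (runSum F k (just p)) e as bs f ≋ sgn e as ·P (consᴾ false 0 (Lᵂ n as) *P runSum F k (just p) bs)
    pathSum-runSum-rows k p e {as} {bs} {f} adm as≺p = begin
      pathSum (runSum F k (just p)) e as bs f
        ≈⟨ pathSum-++ (F k) (runSumTail F k (just p)) e as bs f ⟩
      pathSum (F k) e as bs f ++ pathSum (runSumTail F k (just p)) e as bs f
        ≈⟨ ++-cong (pathSum-consᴾ-Lᵂ false k e adm) (pathSum-runSumTail-rows k p e adm as≺p) ⟩
      sgn e as ·P consᴾ false k (Lᵂ n as *P Lᵂ n bs) ++ sgn e as ·P (consᴾ false 0 (Lᵂ n as) *P T)
        ≡⟨ ·-distrib-++ (sgn e as) (consᴾ false k (Lᵂ n as *P Lᵂ n bs)) _ ⟨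
      sgn e as ·P (consᴾ false k (Lᵂ n as *P Lᵂ n bs) ++ consᴾ false 0 (Lᵂ n as) *P T)
        ≈⟨ ·-cong (sgn e as) (x₁⁰-*-runSum n k (just p) as bs) ⟨
      sgn e as ·P (consᴾ false 0 (Lᵂ n as) *P runSum F k (just p) bs) ∎
      where
      open ≋-Reasoning
      T = runSumTail F k (just p) bs

    pathSum-runSumTail-rows : ∀ k p e {as bs f} → Admissible as bs f → as ≺ᵉ p →
      pathSum (runSumTail F k (just p)) e as bs f
        ≋ sgn e as ·P (consᴾ false 0 (Lᵂ n as) *P runSumTail F k (just p) bs)
    pathSum-runSumTail-rows k p e {as} {bs} {f} adm as≺p = begin
      pathSum T e as bs f
        ≈⟨ pathSum-step T e adm ⟩
      endpoint T as bs ++ (columnFirst T e as bs f′ ++ rowFirst T e as bs f′)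
        ≈⟨ ++-cong (endpoint-vanishing ≋-refl as bs) (++-cong (column as as≺p) (row bs adm)) ⟩
      sgn e as ·P (consᴾ false 0 (Lᵂ n as) *P T bs) ∎
      where
      open ≋-Reasoning
      T = runSumTail F k (just p)
      f′ = ℕ.pred f
      column : ∀ as → as ≺ᵉ p → columnFirst T e as bs f′ ≋ []
      column [] _ = ≋-refl
      column (dot a ∷ as) _ = columnFirst-dot-vanishing {G = T} (λ _ _ → ≋-refl) e a as bs f′
      column (int a ∷ as) as≺p rewrite dec-true (a <? p) (as≺p (here refl)) =
        pathSum-vanishing (λ _ → ≋-refl) e as bs f′
      row : ∀ bs → Admissible as bs f → rowFirst T e as bs f′ ≋ sgn e as ·P (consᴾ false 0 (Lᵂ n as) *P T bs)
      row [] _ = ≋-sym (·-zeroʳ-* (sgn e as) (consᴾ false 0 (Lᵂ n as)))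
      row (dot b ∷ bs) _ = ≋-trans (rowFirst-dot-vanishing {G = T} (λ _ _ → ≋-refl) e as b bs f′)
                                   (≋-sym (·-zeroʳ-* (sgn e as) (consᴾ false 0 (Lᵂ n as))))
      row (int b ∷ bs) adm with isDescent (just p) b
      ... | true  = ≋-trans (pathSum-vanishing (λ _ → ≋-refl) e as bs f′)
                            (≋-sym (·-zeroʳ-* (sgn e as) (consᴾ false 0 (Lᵂ n as))))
      ... | false = pathSum-runSum-rows (suc k) b e (tailʳ adm) (λ a∈ → below adm a∈ (here refl))

  mutual
    pathSum-runSum : ∀ k prev e {as bs f} → Admissible as bs f → prev ≺ᵐ bs →
      pathSum (runSum F k prev) e as bs f ≋ sgn e as ·P (runSum F k prev as *P x₁-part n bs)
    pathSum-runSum k prev e {as} {bs} {f} adm prev≺bs = begin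
      pathSum (runSum F k prev) e as bs f
        ≈⟨ pathSum-++ (F k) (runSumTail F k prev) e as bs f ⟩
      pathSum (F k) e as bs f ++ pathSum (runSumTail F k prev) e as bs f
        ≈⟨ ++-cong (pathSum-consᴾ-Lᵂ false k e adm) (pathSum-runSumTail k prev e adm prev≺bs) ⟩
      σ ·P consᴾ false k (Lᵂ n as *P Lᵂ n bs)
        ++ (σ ·P (consᴾ false k (Lᵂ n as) *P T₀) ++ σ ·P (runSumTail F k prev as *P x₁-part n bs))
        ≡⟨ ·-distrib-++₃ σ (consᴾ false k (Lᵂ n as *P Lᵂ n bs)) (consᴾ false k (Lᵂ n as) *P T₀)
                            (runSumTail F k prev as *P x₁-part n bs) ⟨
      σ ·P (consᴾ false k (Lᵂ n as *P Lᵂ n bs)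
              ++ (consᴾ false k (Lᵂ n as) *P T₀ ++ runSumTail F k prev as *P x₁-part n bs))
        ≈⟨ ·-cong σ (runSum-*-x₁-part n k prev as bs) ⟨
      σ ·P (runSum F k prev as *P x₁-part n bs) ∎
      where
      open ≋-Reasoning
      σ = sgn e as
      T₀ = runSumTail F 0 nothing bs

    pathSum-runSumTail : ∀ k prev e {as bs f} → Admissible as bs f → prev ≺ᵐ bs →
      pathSum (runSumTail F k prev) e as bs f
        ≋ sgn e as ·P (consᴾ false k (Lᵂ n as) *P runSumTail F 0 nothing bs)
          ++ sgn e as ·P (runSumTail F k prev as *P x₁-part n bs)
    pathSum-runSumTail k prev e {as} {bs} {f} adm prev≺bs = begin
      pathSum T e as bs f
        ≈⟨ pathSum-step T e adm ⟩
      endpoint T as bs ++ (columnFirst T e as bs f′ ++ rowFirst T e as bs f′)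
        ≈⟨ ++-cong (endpoint-vanishing ≋-refl as bs) (++-comm (columnFirst T e as bs f′) _) ⟩
      rowFirst T e as bs f′ ++ columnFirst T e as bs f′
        ≈⟨ ++-cong (row bs adm prev≺bs) (column as adm) ⟩
      σ ·P (consᴾ false k (Lᵂ n as) *P runSumTail F 0 nothing bs) ++ σ ·P (T as *P x₁-part n bs) ∎
      where
      open ≋-Reasoning
      T = runSumTail F k prev
      σ = sgn e as
      f′ = ℕ.pred f
      column : ∀ as → Admissible as bs f → columnFirst T e as bs f′ ≋ sgn e as ·P (T as *P x₁-part n bs)
      column [] _ = ≋-refl
      column (dot a ∷ as) _ = columnFirst-dot-vanishing {G = T} (λ _ _ → ≋-refl) e a as bs f′
      column (int a ∷ as) adm with isDescent prev a
      ... | true  = pathSum-vanishing (λ _ → ≋-refl) e as bs f′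
      ... | false = pathSum-runSum (suc k) (just a) e (tailᶜ adm) (below adm (here refl))
      row : ∀ bs → Admissible as bs f → prev ≺ᵐ bs →
        rowFirst T e as bs f′ ≋ σ ·P (consᴾ false k (Lᵂ n as) *P runSumTail F 0 nothing bs)
      row [] _ _ = ≋-sym (·-zeroʳ-* σ (consᴾ false k (Lᵂ n as)))
      row (dot b ∷ bs) _ _ = ≋-trans (rowFirst-dot-vanishing {G = T} (λ _ _ → ≋-refl) e as b bs f′)
                                     (≋-sym (·-zeroʳ-* σ (consᴾ false k (Lᵂ n as))))
      row (int b ∷ bs) adm prev≺bs rewrite no-descent prev prev≺bs = begin
        pathSum (runSum F (suc k) (just b)) e as bs f′
          ≈⟨ pathSum-runSum-rows (suc k) b e (tailʳ adm) (λ a∈ → below adm a∈ (here refl)) ⟩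
        σ ·P (consᴾ false 0 (Lᵂ n as) *P runSum F (suc k) (just b) bs)
          ≡⟨ cong (λ i → σ ·P (consᴾ false 0 (Lᵂ n as) *P runSum F i (just b) bs)) (ℕ.+-comm 1 k) ⟩
        σ ·P (consᴾ false 0 (Lᵂ n as) *P runSum F (k ℕ.+ 1) (just b) bs)
          ≈⟨ ·-cong σ (x₁^-*-runSum n k (Lᵂ n as) 1 (just b) bs) ⟨
        σ ·P (consᴾ false k (Lᵂ n as) *P runSum F 1 (just b) bs) ∎

  pathSum-θ₁-part : ∀ e {as bs f} → Admissible as bs f →
    pathSum (θ₁-part n) e as bs f
      ≋ sgn e as ·P (x₁-part n as *P θ₁-part n bs) ++ sgn e as ·P (θ₁-part n as *P x₁-part n bs)
  pathSum-θ₁-part e {as} {bs} {f} adm = begin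
    pathSum (θ₁-part n) e as bs f
      ≈⟨ pathSum-step (θ₁-part n) e adm ⟩
    endpoint (θ₁-part n) as bs ++ (columnFirst (θ₁-part n) e as bs f′ ++ rowFirst (θ₁-part n) e as bs f′)
      ≈⟨ ++-cong (endpoint-vanishing ≋-refl as bs) (++-comm (columnFirst (θ₁-part n) e as bs f′) _) ⟩
    rowFirst (θ₁-part n) e as bs f′ ++ columnFirst (θ₁-part n) e as bs f′
      ≈⟨ ++-cong (row bs adm) (column as adm) ⟩
    sgn e as ·P (x₁-part n as *P θ₁-part n bs) ++ sgn e as ·P (θ₁-part n as *P x₁-part n bs) ∎
    where
    open ≋-Reasoning
    f′ = ℕ.pred f

    row : ∀ bs → Admissible as bs f →
      rowFirst (θ₁-part n) e as bs f′ ≋ sgn e as ·P (x₁-part n as *P θ₁-part n bs)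
    row [] _ = ≋-sym (·-zeroʳ-* (sgn e as) (x₁-part n as))
    row (int b ∷ bs) _ =
      ≋-trans (pathSum-vanishing (λ _ → ≋-refl) e as bs f′) (≋-sym (·-zeroʳ-* (sgn e as) (x₁-part n as)))
    row (dot b ∷ bs) adm = begin
      pathSum (λ w → consᴾ true b (Lᵂ n w)) (suc e) as bs f′ ++ diagU-steps (θ₁-part n) e as b bs f′
        ≈⟨ ++-cong (pathSum-consᴾ-Lᵂ true b (suc e) adm′)
                   (∑-cong (oneTo (incRun as)) λ k → pathSum-consᴾ-Lᵂ true (b ℕ.+ k) (suc e) (dropᶜ k adm′)) ⟩
      sgn (suc e) as ·P consᴾ true b (Lᵂ n as *P B)
        ++ ∑[ k ∈ oneTo (incRun as) ] sgn (suc e) (drop k as) ·P consᴾ true (b ℕ.+ k) (Lᵂ n (drop k as) *P B)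
        ≡⟨ cong (sgn (suc e) as ·P consᴾ true b (Lᵂ n as *P B) ++_) (∑-≡-∈ (oneTo (incRun as)) λ {k} k∈ →
             cong₂ (λ d i → -1^ (suc e ℕ.* d) ·P consᴾ true i (Lᵂ n (drop k as) *P B))
                   (ndots-drop-∈ as k∈) (ℕ.+-comm b k)) ⟩
      ∑[ k ∈ runLengths as ] sgn (suc e) as ·P S k
        ≡⟨ ∑-· (sgn (suc e) as) (runLengths as) S ⟩
      sgn (suc e) as ·P ∑ (runLengths as) S
        ≡⟨ cong (_·P ∑ (runLengths as) S) (sgn-dotted-row e as) ⟨
      (sgn e as * -1^ ndots as) ·P ∑ (runLengths as) S
        ≡⟨ ·-assoc (sgn e as) (-1^ ndots as) (∑ (runLengths as) S) ⟨
      sgn e as ·P (-1^ ndots as ·P ∑ (runLengths as) S)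
        ≈⟨ ·-cong (sgn e as) (x₁-part-*-θ₁ n b B (permᶜ adm′)) ⟨
      sgn e as ·P (x₁-part n as *P consᴾ true b B) ∎
      where
      adm′ = tailʳ adm
      B = Lᵂ n bs
      S = λ k → consᴾ true (k ℕ.+ b) (Lᵂ n (drop k as) *P B)

    column : ∀ as → Admissible as bs f →
      columnFirst (θ₁-part n) e as bs f′ ≋ sgn e as ·P (θ₁-part n as *P x₁-part n bs)
    column [] _ = ≋-refl
    column (int a ∷ as) _ = pathSum-vanishing (λ _ → ≋-refl) e as bs f′
    column (dot a ∷ as) adm = begin
      -1^ e ·P pathSum (λ w → consᴾ true a (Lᵂ n w)) e as bs f′ ++ diagR-steps (θ₁-part n) e a as bs f′
        ≈⟨ ++-cong (·-cong (-1^ e) (pathSum-consᴾ-Lᵂ true a e adm′))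
                   (∑-cong (oneTo (incRun bs)) λ k →
                      ·-cong (-1^ e) (pathSum-consᴾ-Lᵂ true (a ℕ.+ k) e (dropʳ k adm′))) ⟩
      -1^ e ·P (sgn e as ·P consᴾ true a (Lᵂ n as *P Lᵂ n bs)) ++ diag
        ≡⟨ cong (λ i → -1^ e ·P (sgn e as ·P consᴾ true i (Lᵂ n as *P Lᵂ n bs)) ++ diag) (ℕ.+-identityʳ a) ⟨
      ∑[ k ∈ runLengths bs ] -1^ e ·P (sgn e as ·P S k)
        ≡⟨ ∑-≡ (runLengths bs) (λ k →
             trans (·-assoc (-1^ e) (sgn e as) (S k)) (cong (_·P S k) (sgn-dotted-column e a as))) ⟩
      ∑[ k ∈ runLengths bs ] sgn e (dot a ∷ as) ·P S k
        ≡⟨ ∑-· (sgn e (dot a ∷ as)) (runLengths bs) S ⟩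
      sgn e (dot a ∷ as) ·P ∑ (runLengths bs) S
        ≈⟨ ·-cong (sgn e (dot a ∷ as)) (θ₁-*-x₁-part n a (Lᵂ n as) (permʳ adm′)) ⟨
      sgn e (dot a ∷ as) ·P (consᴾ true a (Lᵂ n as) *P x₁-part n bs) ∎
      where
      adm′ = tailᶜ adm
      S = λ k → consᴾ true (a ℕ.+ k) (Lᵂ n as *P Lᵂ n (drop k bs))
      diag = ∑[ k ∈ oneTo (incRun bs) ] -1^ e ·P (sgn e as ·P S k)

pathSum-Lᵂ : ∀ n → PathSumFormula n
pathSum-Lᵂ zero = pathSum-Lᵂ-zero
pathSum-Lᵂ (suc n) e {as} {bs} {f} adm = begin
  pathSum (Lᵂ (suc n)) e as bs f
    ≈⟨ pathSum-++ (x₁-part n) (θ₁-part n) e as bs f ⟩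
  pathSum (x₁-part n) e as bs f ++ pathSum (θ₁-part n) e as bs f
    ≈⟨ ++-cong (pathSum-runSum 0 nothing e adm _) (pathSum-θ₁-part e adm) ⟩
  σ ·P (Zᵃ *P Zᵇ) ++ (σ ·P (Zᵃ *P Dᵇ) ++ σ ·P (Dᵃ *P Zᵇ))
    ≡⟨ ·-distrib-++₃ σ (Zᵃ *P Zᵇ) (Zᵃ *P Dᵇ) (Dᵃ *P Zᵇ) ⟨
  σ ·P (Zᵃ *P Zᵇ ++ (Zᵃ *P Dᵇ ++ Dᵃ *P Zᵇ))
    ≡⟨ cong (σ ·P_) (List.++-assoc (Zᵃ *P Zᵇ) (Zᵃ *P Dᵇ) (Dᵃ *P Zᵇ)) ⟨
  σ ·P ((Zᵃ *P Zᵇ ++ Zᵃ *P Dᵇ) ++ Dᵃ *P Zᵇ)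
    ≈⟨ ·-cong σ (++-cong (≋-refl {p = Zᵃ *P Zᵇ ++ Zᵃ *P Dᵇ}) DZ+DD≋DZ) ⟨
  σ ·P ((Zᵃ *P Zᵇ ++ Zᵃ *P Dᵇ) ++ (Dᵃ *P Zᵇ ++ Dᵃ *P Dᵇ))
    ≈⟨ ·-cong σ (*-expand Zᵃ Dᵃ Zᵇ Dᵇ) ⟨
  σ ·P (Lᵂ (suc n) as *P Lᵂ (suc n) bs) ∎
  where
  open ≋-Reasoning
  open InductionStep n (pathSum-Lᵂ n)
  σ = sgn e as
  Zᵃ = x₁-part n as
  Zᵇ = x₁-part n bs
  Dᵃ = θ₁-part n as
  Dᵇ = θ₁-part n bs
  DZ+DD≋DZ : Dᵃ *P Zᵇ ++ Dᵃ *P Dᵇ ≋ Dᵃ *P Zᵇ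
  DZ+DD≋DZ = ≋-trans (++-cong (≋-refl {p = Dᵃ *P Zᵇ}) (θ₁-part-*-θ₁-part n as bs)) (++-identityʳ _)

mainTheorem2 :
    (α β : DComp) → IsDottedComposition α → IsDottedComposition β →
    (S T : List ℤ) → Unique S → Unique T →
    (wα wβ : DPerm) → IsDottedPermutation wα → IsDottedPermutation wβ →
    Represents wα α S → Represents wβ β T →
    (∀ s t → s ∈ S → t ∈ T → s < t) →
    (n : ℕ) →
    L n α *P L n β
      ≈P ΣP (map (λ P → sign wα wβ P ·P L n (comp (Π wα wβ P))) (paths wα wβ))
mainTheorem2 _ _ _ _ S T _ _ wα wβ permα permβ (refl , wα↭S) (refl , wβ↭T) S<T n = coeff-≡ (begin
  L n (comp wα) *P L n (comp wβ)                        ≈⟨ *-cong (L-comp n wα) (L-comp n wβ) ⟩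
  Lᵂ n wα *P Lᵂ n wβ                                    ≡⟨ ·-identityˡ _ ⟨
  sgn 0 wα ·P (Lᵂ n wα *P Lᵂ n wβ)                      ≈⟨ pathSum-Lᵂ n 0 admissible ⟨
  pathSum (Lᵂ n) 0 wα wβ (length wα ℕ.+ length wβ)      ≈⟨ pathSum-cong (λ w → ≋-sym (L-comp n w)) 0 wα wβ _ ⟩
  pathSum (L n ∘ comp) 0 wα wβ (length wα ℕ.+ length wβ) ∎)
  where
  open ≋-Reasoning
  admissible : Admissible wα wβ (length wα ℕ.+ length wβ)
  admissible = record
    { fuel  = ℕ.≤-refl
    ; permᶜ = permα
    ; permʳ = permβ
    ; below = λ a∈ b∈ → S<T _ _ (∈-resp-↭ wα↭S a∈) (∈-resp-↭ wβ↭T b∈)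
    }
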